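{- Let $k>9$ be an odd integer and let $r,s\in\mathbb{Z}_{2k}$ be such that $T_2(k,r,s)$ is a connected, simple, vertex-transitive graph. Then $T_2(k,r,s)\cong T_2(k,2,1)$.
   Context: For a positive integer $k$ and $r,s\in\mathbb{Z}_{2k}$, $T_2(k,r,s)$ is the graph with vertex set $\{u_i,v_i,w_i: i\in\mathbb{Z}_{2k}\}$ and edges $w_iw_{i+k}$, $u_iv_i$, $u_iw_i$, $u_iw_{i+r}$, $v_iv_{i+s}$ ($i\in\mathbb{Z}_{2k}$). -}

module Defs where

open import Data.Nat using (ℕ; zero; suc; _+_; _*_; _<_)
open import Data.Nat.DivMod using (_%_; m%n<n)
open import Data.Fin using (Fin; toℕ; fromℕ<)
open import Data.Product using (_×_; _,_; Σ; ∃; proj₁; proj₂)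
open import Data.Sum using (_⊎_)
open import Relation.Binary.PropositionalEquality using (_≡_; _≢_)
open import Relation.Binary.Construct.Closure.ReflexiveTransitive using (Star)
open import Function.Bundles using (_⇔_)

Odd : ℕ → Set
Odd k = ∃ λ m → k ≡ suc (2 * m)

-- ℤ_{2k} is represented by Fin (k + k); addition is taken modulo k + k.
ℤ₂ : ℕ → Set
ℤ₂ k = Fin (k + k)

infixl 6 _⊕_
_⊕_ : ∀ {n} → Fin n → ℕ → Fin n
_⊕_ {suc n} a m = fromℕ< (m%n<n (toℕ a + m) (suc n))

data Kind : Set where
  U V W : Kind

Vertex : ℕ → Set
Vertex k = Kind × ℤ₂ k

-- The five families of edges in the definition of T₂(k,r,s),
-- each indexed by i ∈ ℤ_{2k}:
--   wk : w_i w_{i+k},  uv : u_i v_i,  uw : u_i w_i,  uwr : u_i w_{i+r},  vv : v_i v_{i+s}.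
data EdgeType : Set where
  wk uv uw uwr vv : EdgeType

EdgeIndex : ℕ → Set
EdgeIndex k = EdgeType × ℤ₂ k

ends : (k : ℕ) (r s : ℤ₂ k) → EdgeIndex k → Vertex k × Vertex k
ends k r s (wk  , i) = (W , i) , (W , i ⊕ k)
ends k r s (uv  , i) = (U , i) , (V , i)
ends k r s (uw  , i) = (U , i) , (W , i)
ends k r s (uwr , i) = (U , i) , (W , i ⊕ toℕ r)
ends k r s (vv  , i) = (V , i) , (V , i ⊕ toℕ s)

Adj : (k : ℕ) (r s : ℤ₂ k) → Vertex k → Vertex k → Set
Adj k r s x y = ∃ λ e → (proj₁ (ends k r s e) ≡ x × proj₂ (ends k r s e) ≡ y)
                      ⊎ (proj₁ (ends k r s e) ≡ y × proj₂ (ends k r s e) ≡ x)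

-- Two edge indices describe the same edge of the (multi)graph: they are equal,
-- or they are w_i w_{i+k} and w_{i+k} w_{i+2k} = w_{i+k} w_i (the set
-- {w_i w_{i+k} : i ∈ ℤ_{2k}} is a perfect matching with k edges).
SameEdge : (k : ℕ) → EdgeIndex k → EdgeIndex k → Set
SameEdge k e f = e ≡ f ⊎ (proj₁ e ≡ wk × proj₁ f ≡ wk × proj₂ f ≡ proj₂ e ⊕ k)

SamePair : ∀ {A : Set} → A × A → A × A → Set
SamePair (a , b) (c , d) = (a ≡ c × b ≡ d) ⊎ (a ≡ d × b ≡ c)

Simple : (k : ℕ) (r s : ℤ₂ k) → Set
Simple k r s =
  (∀ e → proj₁ (ends k r s e) ≢ proj₂ (ends k r s e)) ×
  (∀ e f → SamePair (ends k r s e) (ends k r s f) → SameEdge k e f)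

Connected : (k : ℕ) (r s : ℤ₂ k) → Set
Connected k r s = ∀ x y → Star (Adj k r s) x y

IsIso : (k : ℕ) (r s r′ s′ : ℤ₂ k) → (Vertex k → Vertex k) → Set
IsIso k r s r′ s′ f =
  (∀ y → ∃ λ x → f x ≡ y) × (∀ x y → f x ≡ f y → x ≡ y) ×
  (∀ x y → Adj k r s x y ⇔ Adj k r′ s′ (f x) (f y))

Isomorphic : (k : ℕ) (r s r′ s′ : ℤ₂ k) → Set
Isomorphic k r s r′ s′ = ∃ λ f → IsIso k r s r′ s′ f

VertexTransitive : (k : ℕ) (r s : ℤ₂ k) → Set
VertexTransitive k r s =
  ∀ x y → ∃ λ σ → IsIso k r s r s σ × σ x ≡ y

module Submission where

-- Indices live in ℤ_{2k} and every edge moves the index by 0, ±r, ±s or k, so a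
-- walk is tracked by an offset a·r + b·s + c·k, and a closed walk yields a
-- relation a·r + b·s + c·k ≡ 0 (mod 2k).  The proof follows the paper:
--  * simplicity gives r, s, 2s ≢ 0; connectivity excludes a common divisor
--    d ≥ 2 of r, s and k;
--  * "angles" (pairs of edges on a short non-backtracking closed walk) are
--    preserved by automorphisms.  Every w-vertex has two angles with a common
--    arm; at a v-vertex this forces r ≡ ±s, r ≡ ±(s + k), r ≡ ∓2s or s ≡ −k;
--  * if r ≡ ±s or ±(s + k), every u-vertex has three pairwise angles; at a
--    v-vertex this forces r ≡ ∓2s or m·s ≡ 0 with 3 ≤ m ≤ 6, which arithmetic
--    excludes for odd k > 9;
--  * if r ≡ ∓2s, then s is coprime to k.  For even s the v-vertices lie on a
--    closed walk of odd length k and the u-vertices do not; for odd s,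
--    multiplication by ∓s⁻¹ (mod 2k) is an isomorphism onto T₂(k,2,1).

open import Defs
open import Data.Nat as ℕ using (ℕ; zero; suc; z≤n; s≤s; _∸_)
import Data.Nat.Properties as ℕP
import Data.Nat.Tactic.RingSolver as ℕSolver
open import Data.Nat.DivMod using (_%_; _/_; m≡m%n+[m/n]*n)
import Data.Nat.Divisibility as ℕD
open import Data.Nat.Coprimality using (Coprime; coprime-Bézout; coprime-divisor) renaming (sym to coprime-sym)
open import Data.Nat.GCD using (module Bézout)
open import Data.Integer as ℤ using (ℤ; +_; _+_; _*_; -_; _-_; ∣_∣)
import Data.Integer.Properties as ℤP
import Data.Integer.DivMod as ℤD
open import Data.Integer.Divisibility.Signed
  using (_∣_; divides; ∣⇒∣ᵤ; ∣ᵤ⇒∣; ∣-refl; ∣-trans; ∣m∣n⇒∣m+n; ∣m∣n⇒∣m-n; ∣m⇒∣-m; ∣n⇒∣m*n; ∣m⇒∣m*n; *-cancelˡ-∣)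
open import Data.Integer.Tactic.RingSolver using (solve-∀)
open import Data.Fin as Fin using (toℕ; fromℕ<)
import Data.Fin.Properties as FinP
open import Data.Product using (_×_; _,_; ∃; proj₁; proj₂)
open import Data.Sum using (_⊎_; inj₁; inj₂; [_,_]′)
open import Data.Empty using (⊥; ⊥-elim)
open import Data.Unit using (⊤)
open import Relation.Nullary using (¬_; yes; no)
open import Relation.Nullary.Decidable using (from-yes)
open import Data.Nat.Primality using (Prime; prime?; prime⇒irreducible; prime⇒nonZero; prime[2])
open import Relation.Binary.PropositionalEquality
open import Relation.Binary.Construct.Closure.ReflexiveTransitive as Star using (Star; _◅_)
open import Function.Bundles using (_⇔_; mk⇔; Equivalence)

below-divisor : ∀ {n m} → m ℕ.< n → n ℕD.∣ m → m ≡ 0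
below-divisor {m = zero} _ _ = refl
below-divisor {m = suc m} m<n n∣m = ⊥-elim (ℕD.>⇒∤ m<n n∣m)

-- If b ≤ a < n and a ≡ b (mod n) then a = b: a − b = a ∸ b is a multiple of n below n.
congruent-below : ∀ {n a b} → b ℕ.≤ a → a ℕ.< n → + n ∣ + a - + b → a ≡ b
congruent-below {n} {a} {b} b≤a a<n n∣a-b = begin
    a             ≡⟨ ℕP.m∸n+n≡m b≤a ⟨
    a ∸ b ℕ.+ b   ≡⟨ cong (ℕ._+ b) (below-divisor (ℕP.≤-<-trans (ℕP.m∸n≤m a b) a<n) (∣⇒∣ᵤ n∣a∸b)) ⟩
    b             ∎
  where
  open ≡-Reasoning
  n∣a∸b : + n ∣ + (a ∸ b)
  n∣a∸b = subst (+ n ∣_) (trans (ℤP.[+m]-[+n]≡m⊖n a b) (ℤP.⊖-≥ b≤a)) n∣a-b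

residue-unique : ∀ {n a b} → a ℕ.< n → b ℕ.< n → + n ∣ + a - + b → a ≡ b
residue-unique {n} {a} {b} a<n b<n n∣a-b with ℕP.≤-total b a
... | inj₁ b≤a = congruent-below b≤a a<n n∣a-b
... | inj₂ a≤b = sym (congruent-below a≤b b<n (subst (+ n ∣_) (neg-swap (+ a) (+ b)) (∣m⇒∣-m n∣a-b)))
  where
  neg-swap : ∀ x y → - (x - y) ≡ y - x
  neg-swap = solve-∀

one-not-multiple : ∀ {d} → 2 ℕ.≤ d → ¬ (+ d ∣ + 1)
one-not-multiple 2≤d d∣1 with ℕD.∣1⇒≡1 (∣⇒∣ᵤ d∣1)
one-not-multiple (s≤s ()) _ | refl

cancel-unit : ∀ {n} (c c′ j x : ℤ) → c * c′ ≡ + 1 + j * + n → + n ∣ c * x → + n ∣ x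
cancel-unit {n} c c′ j x cc′ n∣cx =
  subst (+ n ∣_) x≡ (∣m∣n⇒∣m-n (∣n⇒∣m*n c′ n∣cx) (divides (j * x) refl))
  where
  open ≡-Reasoning
  rearrange : ∀ c c′ j x n → c′ * (c * x) - j * x * n ≡ (c * c′) * x - (j * n) * x
  rearrange = solve-∀
  cancel : ∀ j x n → (+ 1 + j * n) * x - (j * n) * x ≡ x
  cancel = solve-∀
  x≡ : c′ * (c * x) - j * x * + n ≡ x
  x≡ = begin
    c′ * (c * x) - j * x * + n          ≡⟨ rearrange c c′ j x (+ n) ⟩
    (c * c′) * x - (j * + n) * x        ≡⟨ cong (λ z → z * x - (j * + n) * x) cc′ ⟩
    (+ 1 + j * + n) * x - (j * + n) * x ≡⟨ cancel j x (+ n) ⟩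
    x                                   ∎

odd-form : ∀ {n} (o : Odd n) → + n ≡ + 1 + + 2 * + proj₁ o
odd-form {n} (m , n≡) = trans (cong +_ n≡) (trans (ℤP.pos-+ 1 (2 ℕ.* m)) (cong (λ z → + 1 + z) (ℤP.pos-* 2 m)))

-- An offset a·r + b·s + c·k in T₂(k,r,s), recorded by its coefficients (a, b, c).
record Offset : Set where
  constructor offset
  field
    r-coeff s-coeff k-coeff : ℤ

infixl 6 _⊞_
_⊞_ : Offset → Offset → Offset
offset a b c ⊞ offset a′ b′ c′ = offset (a + a′) (b + b′) (c + c′)

⊟_ : Offset → Offset
⊟ offset a b c = offset (- a) (- b) (- c)

𝟎 r⁺ r⁻ s⁺ s⁻ k⁺ : Offset
𝟎  = offset (+ 0) (+ 0) (+ 0)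
r⁺ = offset (+ 1) (+ 0) (+ 0)
r⁻ = offset (- + 1) (+ 0) (+ 0)
s⁺ = offset (+ 0) (+ 1) (+ 0)
s⁻ = offset (+ 0) (- + 1) (+ 0)
k⁺ = offset (+ 0) (+ 0) (+ 1)

-- Local configurations in a graph given by an adjacency relation Adj; each is
-- defined from adjacency and distinctness only, so injective homomorphisms carry
-- them along (module Image).
module Configurations {A : Set} (Adj : A → A → Set) where

  -- Closed walks x₀ x₁ … x_{n-1} x₀ of length n = 3, …, 6 without backtracking,
  -- i.e. with x_{i+2} ≢ x_i for all i (indices mod n).
  Loop3 : A → A → A → Set
  Loop3 a b c = Adj a b × Adj b c × Adj c a × (c ≢ a) × (a ≢ b) × (b ≢ c)
  Loop4 : A → A → A → A → Set
  Loop4 a b c d = Adj a b × Adj b c × Adj c d × Adj d a × (c ≢ a) × (d ≢ b) × (a ≢ c) × (b ≢ d)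
  Loop5 : A → A → A → A → A → Set
  Loop5 a b c d e = Adj a b × Adj b c × Adj c d × Adj d e × Adj e a ×
                    (c ≢ a) × (d ≢ b) × (e ≢ c) × (a ≢ d) × (b ≢ e)
  Loop6 : A → A → A → A → A → A → Set
  Loop6 a b c d e f = Adj a b × Adj b c × Adj c d × Adj d e × Adj e f × Adj f a ×
                      (c ≢ a) × (d ≢ b) × (e ≢ c) × (f ≢ d) × (a ≢ e) × (b ≢ f)

  -- An angle y x z: some short non-backtracking closed walk runs z → x → y.
  Angle : A → A → A → Set
  Angle x y z = Loop3 x y z ⊎ (∃ λ c → Loop4 x y c z) ⊎ (∃ λ c → ∃ λ d → Loop5 x y c d z)
              ⊎ (∃ λ c → ∃ λ d → ∃ λ e → Loop6 x y c d e z)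

  angle5 : ∀ {a b c d e} → Loop5 a b c d e → Angle a b e
  angle5 l = inj₂ (inj₂ (inj₁ (_ , _ , l)))
  angle6 : ∀ {a b c d e f} → Loop6 a b c d e f → Angle a b f
  angle6 l = inj₂ (inj₂ (inj₂ (_ , _ , _ , l)))

  angle-first : ∀ {x y z} → Angle x y z → Adj x y
  angle-first (inj₁ p) = proj₁ p
  angle-first (inj₂ (inj₁ (_ , p))) = proj₁ p
  angle-first (inj₂ (inj₂ (inj₁ (_ , _ , p)))) = proj₁ p
  angle-first (inj₂ (inj₂ (inj₂ (_ , _ , _ , p)))) = proj₁ p

  angle-last : ∀ {x y z} → Angle x y z → Adj z x
  angle-last (inj₁ (_ , _ , a , _)) = a
  angle-last (inj₂ (inj₁ (_ , _ , _ , _ , a , _))) = a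
  angle-last (inj₂ (inj₂ (inj₁ (_ , _ , _ , _ , _ , _ , a , _)))) = a
  angle-last (inj₂ (inj₂ (inj₂ (_ , _ , _ , _ , _ , _ , _ , _ , a , _)))) = a

  angle-arms : ∀ {x y z} → Angle x y z → z ≢ y
  angle-arms (inj₁ (_ , _ , _ , _ , _ , n)) e = n (sym e)
  angle-arms (inj₂ (inj₁ (_ , _ , _ , _ , _ , _ , n , _ , _))) = n
  angle-arms (inj₂ (inj₂ (inj₁ (_ , _ , _ , _ , _ , _ , _ , _ , _ , _ , _ , n)))) e = n (sym e)
  angle-arms (inj₂ (inj₂ (inj₂ (_ , _ , _ , _ , _ , _ , _ , _ , _ , _ , _ , _ , _ , _ , n)))) e = n (sym e)

  TwoAngles : A → Set
  TwoAngles x = ∃ λ y → ∃ λ z → ∃ λ t → (z ≢ t) × Angle x y z × Angle x y t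

  ThreeAngles : A → Set
  ThreeAngles x = ∃ λ y → ∃ λ z → ∃ λ t → (y ≢ z) × (z ≢ t) × (t ≢ y) ×
                  Angle x y z × Angle x z t × Angle x t y

  infixr 5 _∷_
  data Walk : ℕ → A → A → Set where
    []  : ∀ {x} → Walk 0 x x
    _∷_ : ∀ {n x y z} → Adj x y → Walk n y z → Walk (suc n) x z

  OddClosedWalk : ℕ → A → Set
  OddClosedWalk b x = ∃ λ L → Odd L × L ℕ.≤ b × Walk L x x

  module Image (f : A → A) (hom : ∀ {x y} → Adj x y → Adj (f x) (f y))
               (inj : ∀ {x y} → f x ≡ f y → x ≡ y) where

    private
      ne : ∀ {x y} → x ≢ y → f x ≢ f y
      ne x≢y fx≡fy = x≢y (inj fx≡fy)

    angle : ∀ {x y z} → Angle x y z → Angle (f x) (f y) (f z)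
    angle (inj₁ (a1 , a2 , a3 , n1 , n2 , n3)) = inj₁ (hom a1 , hom a2 , hom a3 , ne n1 , ne n2 , ne n3)
    angle (inj₂ (inj₁ (c , a1 , a2 , a3 , a4 , n1 , n2 , n3 , n4))) =
      inj₂ (inj₁ (f c , hom a1 , hom a2 , hom a3 , hom a4 , ne n1 , ne n2 , ne n3 , ne n4))
    angle (inj₂ (inj₂ (inj₁ (c , d , a1 , a2 , a3 , a4 , a5 , n1 , n2 , n3 , n4 , n5)))) =
      inj₂ (inj₂ (inj₁ (f c , f d , hom a1 , hom a2 , hom a3 , hom a4 , hom a5 ,
                        ne n1 , ne n2 , ne n3 , ne n4 , ne n5)))
    angle (inj₂ (inj₂ (inj₂ (c , d , e , a1 , a2 , a3 , a4 , a5 , a6 , n1 , n2 , n3 , n4 , n5 , n6)))) =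
      inj₂ (inj₂ (inj₂ (f c , f d , f e , hom a1 , hom a2 , hom a3 , hom a4 , hom a5 , hom a6 ,
                        ne n1 , ne n2 , ne n3 , ne n4 , ne n5 , ne n6)))

    twoAngles : ∀ {x} → TwoAngles x → TwoAngles (f x)
    twoAngles (y , z , t , n , a1 , a2) = f y , f z , f t , ne n , angle a1 , angle a2

    threeAngles : ∀ {x} → ThreeAngles x → ThreeAngles (f x)
    threeAngles (y , z , t , n1 , n2 , n3 , a1 , a2 , a3) =
      f y , f z , f t , ne n1 , ne n2 , ne n3 , angle a1 , angle a2 , angle a3

    walk : ∀ {n x y} → Walk n x y → Walk n (f x) (f y)
    walk [] = []
    walk (a ∷ w) = hom a ∷ walk w

    oddClosedWalk : ∀ {b x} → OddClosedWalk b x → OddClosedWalk b (f x)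
    oddClosedWalk (L , odd , L≤b , w) = L , odd , L≤b , walk w

module Indices (k′ : ℕ) where

  K N : ℕ
  K = suc k′
  N = K ℕ.+ K

  Ix : Set
  Ix = ℤ₂ K

  Vx : Set
  Vx = Vertex K

  ι : Ix → ℤ
  ι i = + toℕ i

  κ : ℤ
  κ = + K

  N∣2κ : + N ∣ κ + κ
  N∣2κ = subst (+ N ∣_) (ℤP.pos-+ K K) (divides (+ 1) (sym (ℤP.*-identityˡ (+ N))))

  ∣κ⇒∣N : ∀ {d} → d ∣ κ → d ∣ + N
  ∣κ⇒∣N {d} d∣κ = subst (d ∣_) (sym (ℤP.pos-+ K K)) (∣m∣n⇒∣m+n d∣κ d∣κ)

  K∣N : + K ∣ + N
  K∣N = ∣κ⇒∣N ∣-refl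

  2∣N : + 2 ∣ + N
  2∣N = divides κ (double κ)
    where
    double : ∀ k → k + k ≡ k * + 2
    double = solve-∀

  index-unique : ∀ {i j : Ix} → + N ∣ ι i - ι j → i ≡ j
  index-unique {i} {j} n∣ = FinP.toℕ-injective (residue-unique (FinP.toℕ<n i) (FinP.toℕ<n j) n∣)

  ⊕-residue : ∀ (i : Ix) (m : ℕ) → + N ∣ ι (i ⊕ m) - ι i - + m
  ⊕-residue i m = divides (- + (a / N)) (begin
      ι (i ⊕ m) - ι i - + m                          ≡⟨ cong (λ z → z - ι i - + m) (cong +_ (FinP.toℕ-fromℕ< _)) ⟩
      + (a % N) - ι i - + m                          ≡⟨ rearrange (+ (a % N)) (ι i) (+ m) ⟩
      + (a % N) - (+ a)                              ≡⟨ cong (λ z → + (a % N) - z) a≡ ⟩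
      + (a % N) - (+ (a % N) + + (a / N) * + N)      ≡⟨ cancel (+ (a % N)) (+ (a / N)) (+ N) ⟩
      - + (a / N) * + N                              ∎)
    where
    open ≡-Reasoning
    a = toℕ i ℕ.+ m
    a≡ : + a ≡ + (a % N) + + (a / N) * + N
    a≡ = trans (cong +_ (m≡m%n+[m/n]*n a N))
               (trans (ℤP.pos-+ (a % N) _) (cong (λ z → + (a % N) + z) (ℤP.pos-* (a / N) N)))
    rearrange : ∀ x y z → x - y - z ≡ x - (y + z)
    rearrange = solve-∀
    cancel : ∀ x q n → x - (x + q * n) ≡ - q * n
    cancel = solve-∀


module T2 (k′ : ℕ) (r s : ℤ₂ (suc k′)) where
  open Indices k′ public

  Adjacent : Vx → Vx → Set
  Adjacent = Adj K r s

  open Configurations Adjacent public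

  ρ σ : ℤ
  ρ = ι r
  σ = ι s

  value : Offset → ℤ
  value (offset a b c) = a * ρ + b * σ + c * κ

  record Gap (i j : Ix) (v : Offset) : Set where
    constructor gap
    field congruence : + N ∣ ι j - ι i - value v
  open Gap public

  record Vanishes (v : Offset) : Set where
    constructor vanishes
    field multiple : + N ∣ value v
  open Vanishes public

  gap-refl : ∀ {i} → Gap i i 𝟎
  gap-refl {i} = gap (subst (+ N ∣_) (sym (zero-gap (ι i) ρ σ κ)) (divides (+ 0) refl))
    where
    zero-gap : ∀ x r s k → x - x - (+ 0 * r + + 0 * s + + 0 * k) ≡ + 0
    zero-gap = solve-∀

  infixl 5 _⨾_
  _⨾_ : ∀ {i j l v w} → Gap i j v → Gap j l w → Gap i l (v ⊞ w)
  _⨾_ {i} {j} {l} {offset a b c} {offset a′ b′ c′} (gap g) (gap h) =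
    gap (subst (+ N ∣_) (sum (ι i) (ι j) (ι l) a b c a′ b′ c′ ρ σ κ) (∣m∣n⇒∣m+n g h))
    where
    sum : ∀ i j l a b c a′ b′ c′ r s k →
          (j - i - (a * r + b * s + c * k)) + (l - j - (a′ * r + b′ * s + c′ * k))
            ≡ l - i - ((a + a′) * r + (b + b′) * s + (c + c′) * k)
    sum = solve-∀

  gap-sym : ∀ {i j v} → Gap i j v → Gap j i (⊟ v)
  gap-sym {i} {j} {offset a b c} (gap g) = gap (subst (+ N ∣_) (negate (ι i) (ι j) a b c ρ σ κ) (∣m⇒∣-m g))
    where
    negate : ∀ i j a b c r s k → - (j - i - (a * r + b * s + c * k)) ≡ i - j - (- a * r + - b * s + - c * k)
    negate = solve-∀

  gap-loop : ∀ {i v} → Gap i i v → Vanishes v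
  gap-loop {i} {v} (gap g) = vanishes (subst (+ N ∣_) (close (ι i) (value v)) (∣m⇒∣-m g))
    where
    close : ∀ i x → - (i - i - x) ≡ x
    close = solve-∀

  gap-vanishing : ∀ {i j v} → Gap i j v → Vanishes v → j ≡ i
  gap-vanishing {i} {j} {v} (gap g) (vanishes z) =
    index-unique (subst (+ N ∣_) (cancel (ι i) (ι j) (value v)) (∣m∣n⇒∣m+n g z))
    where
    cancel : ∀ i j x → j - i - x + x ≡ j - i
    cancel = solve-∀

  vanishes-𝟎 : Vanishes 𝟎
  vanishes-𝟎 = vanishes (divides (+ 0) refl)

  vanishes-2k : Vanishes (offset (+ 0) (+ 0) (+ 2))
  vanishes-2k = vanishes (subst (+ N ∣_) (two-k ρ σ κ) N∣2κ)
    where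
    two-k : ∀ r s k → k + k ≡ + 0 * r + + 0 * s + + 2 * k
    two-k = solve-∀

  vanishes-⊞ : ∀ {v w} → Vanishes v → Vanishes w → Vanishes (v ⊞ w)
  vanishes-⊞ {offset a b c} {offset a′ b′ c′} (vanishes x) (vanishes y) =
    vanishes (subst (+ N ∣_) (sum a b c a′ b′ c′ ρ σ κ) (∣m∣n⇒∣m+n x y))
    where
    sum : ∀ a b c a′ b′ c′ r s k → (a * r + b * s + c * k) + (a′ * r + b′ * s + c′ * k)
          ≡ (a + a′) * r + (b + b′) * s + (c + c′) * k
    sum = solve-∀

  vanishes-⊟ : ∀ {v} → Vanishes v → Vanishes (⊟ v)
  vanishes-⊟ {offset a b c} (vanishes x) = vanishes (subst (+ N ∣_) (negate a b c ρ σ κ) (∣m⇒∣-m x))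
    where
    negate : ∀ a b c r s k → - (a * r + b * s + c * k) ≡ - a * r + - b * s + - c * k
    negate = solve-∀

  infixl 6 _⊞₀_
  _⊞₀_ : ∀ {i j v w} → Gap i j v → Vanishes w → Gap i j (v ⊞ w)
  _⊞₀_ {i} {j} {offset a b c} {offset a′ b′ c′} (gap g) (vanishes z) =
    gap (subst (+ N ∣_) (absorb (ι i) (ι j) a b c a′ b′ c′ ρ σ κ) (∣m∣n⇒∣m-n g z))
    where
    absorb : ∀ i j a b c a′ b′ c′ r s k → j - i - (a * r + b * s + c * k) - (a′ * r + b′ * s + c′ * k)
             ≡ j - i - ((a + a′) * r + (b + b′) * s + (c + c′) * k)
    absorb = solve-∀

  apart : ∀ {X i j v} → Gap i j v → ¬ Vanishes v → _≢_ {A = Vx} (X , j) (X , i)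
  apart g v≉0 e = v≉0 (gap-loop (subst (λ l → Gap _ l _) (cong proj₂ e) g))

  gap-𝟎 : ∀ {i j} → Gap i j 𝟎 → j ≡ i
  gap-𝟎 g = gap-vanishing g vanishes-𝟎

  gap-2k : ∀ {i j} → Gap i j (offset (+ 0) (+ 0) (+ 2)) → j ≡ i
  gap-2k g = gap-vanishing g vanishes-2k

  same : ∀ X {i j} → Gap i j 𝟎 → _≡_ {A = Vx} (X , j) (X , i)
  same X g = cong (X ,_) (gap-𝟎 g)

  same₂ₖ : ∀ X {i j} → Gap i j (offset (+ 0) (+ 0) (+ 2)) → _≡_ {A = Vx} (X , j) (X , i)
  same₂ₖ X g = cong (X ,_) (gap-2k g)

  gap-functional : ∀ {i j l v} → Gap i j v → Gap i l v → j ≡ l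
  gap-functional {v = offset a b c} g h =
    sym (gap-vanishing (gap-sym g ⨾ h) (vanishes (subst (+ N ∣_) (sym (cancel a b c ρ σ κ)) (divides (+ 0) refl))))
    where
    cancel : ∀ a b c r s k → (- a + a) * r + (- b + b) * s + (- c + c) * k ≡ + 0
    cancel = solve-∀

  shift : ∀ (i : Ix) (m : ℕ) (v : Offset) → + m ≡ value v → Gap i (i ⊕ m) v
  shift i m v m≡ = gap (subst (λ z → + N ∣ ι (i ⊕ m) - ι i - z) m≡ (⊕-residue i m))

  shift-r : ∀ i → Gap i (i ⊕ toℕ r) r⁺
  shift-r i = shift i (toℕ r) r⁺ (only-r ρ σ κ)
    where
    only-r : ∀ r s k → r ≡ + 1 * r + + 0 * s + + 0 * k
    only-r = solve-∀

  shift-s : ∀ i → Gap i (i ⊕ toℕ s) s⁺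
  shift-s i = shift i (toℕ s) s⁺ (only-s ρ σ κ)
    where
    only-s : ∀ r s k → s ≡ + 0 * r + + 1 * s + + 0 * k
    only-s = solve-∀

  shift-k : ∀ i → Gap i (i ⊕ K) k⁺
  shift-k i = shift i K k⁺ (only-k ρ σ κ)
    where
    only-k : ∀ r s k → k ≡ + 0 * r + + 0 * s + + 1 * k
    only-k = solve-∀

  data Edge : Vx → Vx → Set where
    u-v  : ∀ {i} → Edge (U , i) (V , i)
    u-w  : ∀ {i} → Edge (U , i) (W , i)
    u-wʳ : ∀ {i j} → Gap i j r⁺ → Edge (U , i) (W , j)
    v-u  : ∀ {i} → Edge (V , i) (U , i)
    v-v⁺ : ∀ {i j} → Gap i j s⁺ → Edge (V , i) (V , j)
    v-v⁻ : ∀ {i j} → Gap i j s⁻ → Edge (V , i) (V , j)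
    w-u  : ∀ {i} → Edge (W , i) (U , i)
    w-uʳ : ∀ {i j} → Gap i j r⁻ → Edge (W , i) (U , j)
    w-w  : ∀ {i j} → Gap i j k⁺ → Edge (W , i) (W , j)

  -- w_{i+k} w_i is again an edge of the perfect matching, since 2k ≡ 0.
  private
    back-k : ∀ i → Gap (i ⊕ K) i k⁺
    back-k i = gap (subst (+ N ∣_) (twice (ι i) (ι (i ⊕ K)) κ ρ σ)
                     (∣m∣n⇒∣m-n (∣m⇒∣-m (congruence (shift-k i))) N∣2κ))
      where
      twice : ∀ i j k r s → - (j - i - (+ 0 * r + + 0 * s + + 1 * k)) - (k + k) ≡ i - j - (+ 0 * r + + 0 * s + + 1 * k)
      twice = solve-∀

  edge-view : ∀ {x y} → Adjacent x y → Edge x y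
  edge-view ((wk  , i) , inj₁ (refl , refl)) = w-w (shift-k i)
  edge-view ((wk  , i) , inj₂ (refl , refl)) = w-w (back-k i)
  edge-view ((uv  , i) , inj₁ (refl , refl)) = u-v
  edge-view ((uv  , i) , inj₂ (refl , refl)) = v-u
  edge-view ((uw  , i) , inj₁ (refl , refl)) = u-w
  edge-view ((uw  , i) , inj₂ (refl , refl)) = w-u
  edge-view ((uwr , i) , inj₁ (refl , refl)) = u-wʳ (shift-r i)
  edge-view ((uwr , i) , inj₂ (refl , refl)) = w-uʳ (gap-sym (shift-r i))
  edge-view ((vv  , i) , inj₁ (refl , refl)) = v-v⁺ (shift-s i)
  edge-view ((vv  , i) , inj₂ (refl , refl)) = v-v⁻ (gap-sym (shift-s i))

  edge-adj : ∀ {x y} → Edge x y → Adjacent x y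
  edge-adj (u-v {i}) = (uv , i) , inj₁ (refl , refl)
  edge-adj (u-w {i}) = (uw , i) , inj₁ (refl , refl)
  edge-adj (u-wʳ {i} g) = (uwr , i) , inj₁ (refl , cong (W ,_) (gap-functional (shift-r i) g))
  edge-adj (v-u {i}) = (uv , i) , inj₂ (refl , refl)
  edge-adj (v-v⁺ {i} g) = (vv , i) , inj₁ (refl , cong (V ,_) (gap-functional (shift-s i) g))
  edge-adj (v-v⁻ {i} {j} g) = (vv , j) , inj₂ (refl , cong (V ,_) (gap-functional (shift-s j) (gap-sym g)))
  edge-adj (w-u {i}) = (uw , i) , inj₂ (refl , refl)
  edge-adj (w-uʳ {i} {j} g) = (uwr , j) , inj₂ (refl , cong (W ,_) (gap-functional (shift-r j) (gap-sym g)))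
  edge-adj (w-w {i} g) = (wk , i) , inj₁ (refl , cong (W ,_) (gap-functional (shift-k i) g))

  module _ {i j : Ix} (g : Gap i j 𝟎) where
    adj-uw : Adjacent (U , i) (W , j)
    adj-uw = subst (λ l → Adjacent (U , i) (W , l)) (sym (gap-𝟎 g)) (edge-adj u-w)
    adj-wu : Adjacent (W , i) (U , j)
    adj-wu = subst (λ l → Adjacent (W , i) (U , l)) (sym (gap-𝟎 g)) (edge-adj w-u)

  edge-offset : ∀ {x y} → Edge x y → Offset
  edge-offset (u-wʳ _) = r⁺
  edge-offset (v-v⁺ _) = s⁺
  edge-offset (v-v⁻ _) = s⁻
  edge-offset (w-uʳ _) = r⁻
  edge-offset (w-w _) = k⁺
  edge-offset _ = 𝟎

  edge-gap : ∀ {x y} (e : Edge x y) → Gap (proj₂ x) (proj₂ y) (edge-offset e)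
  edge-gap u-v = gap-refl
  edge-gap u-w = gap-refl
  edge-gap (u-wʳ g) = g
  edge-gap v-u = gap-refl
  edge-gap (v-v⁺ g) = g
  edge-gap (v-v⁻ g) = g
  edge-gap w-u = gap-refl
  edge-gap (w-uʳ g) = g
  edge-gap (w-w g) = g

  move : VertexTransitive K r s → {P : Vx → Set} →
         (∀ f (hom : ∀ {x y} → Adjacent x y → Adjacent (f x) (f y)) (inj : ∀ {x y} → f x ≡ f y → x ≡ y) →
            ∀ {x} → P x → P (f x)) →
         ∀ x y → P x → P y
  move vt {P} preserved x y p with vt x y
  ... | f , (_ , inj , adj) , fx≡y =
    subst P fx≡y (preserved f (λ {a} {b} → Equivalence.to (adj a b)) (λ {a} {b} → inj a b) p)

module SimpleT2 {k′ : ℕ} {r s : ℤ₂ (suc k′)} (simple : Simple (suc k′) r s) where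
  open T2 k′ r s

  -- Stated at an arbitrary index i, so that i ⊕ m is never unfolded.
  private
    module At (i : Ix) where
      -- otherwise v_i v_{i+s} is a loop
      s≉0 : ¬ Vanishes s⁺
      s≉0 z = proj₁ simple (vv , i) (cong (V ,_) (sym (gap-vanishing (shift-s i) z)))

      -- otherwise u_i w_i and u_i w_{i+r} are parallel edges
      r≉0 : ¬ Vanishes r⁺
      r≉0 z = distinct (proj₂ simple (uw , i) (uwr , i) (inj₁ (refl , cong (W ,_) (sym (gap-vanishing (shift-r i) z)))))
        where
        distinct : ¬ SameEdge K (uw , i) (uwr , i)
        distinct (inj₁ ())
        distinct (inj₂ (() , _))

      -- otherwise v_i v_{i+s} and v_{i+s} v_{i+2s} are parallel edges
      2s≉0 : ¬ Vanishes (offset (+ 0) (+ 2) (+ 0))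
      2s≉0 z = distinct (proj₂ simple (vv , i) (vv , i ⊕ toℕ s)
                 (inj₂ (cong (V ,_) (sym (gap-vanishing (shift-s i ⨾ shift-s (i ⊕ toℕ s)) z)) , refl)))
        where
        distinct : ¬ SameEdge K (vv , i) (vv , i ⊕ toℕ s)
        distinct (inj₁ e) = s≉0 (gap-loop (subst (λ j → Gap i j s⁺) (sym (cong proj₂ e)) (shift-s i)))
        distinct (inj₂ (() , _))

  r≉0 : ¬ Vanishes r⁺
  r≉0 = At.r≉0 Fin.zero

  2s≉0 : ¬ Vanishes (offset (+ 0) (+ 2) (+ 0))
  2s≉0 = At.2s≉0 Fin.zero

-- A common divisor d of r, s and k divides every index difference along a walk,
-- so for d ≥ 2 the graph T₂(k,r,s) is disconnected.
module CommonDivisor {k′ : ℕ} {r s : ℤ₂ (suc k′)} {d : ℕ} where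
  open T2 k′ r s

  module _ (d∣r : + d ∣ ρ) (d∣s : + d ∣ σ) (d∣k : + d ∣ κ) where
    private
      d∣N : + d ∣ + N
      d∣N = ∣κ⇒∣N d∣k

      d∣value : ∀ v → + d ∣ value v
      d∣value (offset a b c) = ∣m∣n⇒∣m+n (∣m∣n⇒∣m+n (∣n⇒∣m*n a d∣r) (∣n⇒∣m*n b d∣s)) (∣n⇒∣m*n c d∣k)

      d∣gap : ∀ {i j v} → Gap i j v → + d ∣ ι j - ι i
      d∣gap {i} {j} {v} (gap g) =
        subst (+ d ∣_) (cancel (ι i) (ι j) (value v)) (∣m∣n⇒∣m+n (∣-trans d∣N g) (d∣value v))
        where
        cancel : ∀ i j x → j - i - x + x ≡ j - i
        cancel = solve-∀

      d∣walk : ∀ {x y} → Star Adjacent x y → + d ∣ ι (proj₂ y) - ι (proj₂ x)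
      d∣walk {_ , i} Star.ε = subst (+ d ∣_) (sym (ℤP.+-inverseʳ (ι i))) (divides (+ 0) refl)
      d∣walk {x} {z} (_◅_ {j = y} a w) =
        subst (+ d ∣_) (telescope (ι (proj₂ x)) (ι (proj₂ y)) (ι (proj₂ z))) (∣m∣n⇒∣m+n (d∣walk w) (d∣gap (edge-gap (edge-view a))))
        where
        telescope : ∀ a b c → (c - b) + (b - a) ≡ c - a
        telescope = solve-∀

    disconnected : 2 ℕ.≤ d → ¬ Connected K r s
    disconnected 2≤d conn =
      one-not-multiple 2≤d (subst (+ d ∣_) (one (ι i₀) (ι (i₀ ⊕ 1)))
        (∣m∣n⇒∣m-n (d∣walk (conn (U , i₀) (U , i₀ ⊕ 1))) (∣-trans d∣N (⊕-residue i₀ 1))))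
      where
      i₀ : Ix
      i₀ = Fin.zero
      one : ∀ a b → (b - a) - (b - a - + 1) ≡ + 1
      one = solve-∀

-- Adding up the offsets around a short non-backtracking closed walk through v_i
-- gives a vanishing offset; when the walk passes through u_i, or leaves and
-- enters v_i along V–V edges, this vanishing offset is one of a short list.
module LoopsAtV (k′ : ℕ) (r s : ℤ₂ (suc k′)) where
  open T2 k′ r s

  data RelationViaU : Set where
    s≈r    : Vanishes (offset (- + 1) (+ 1) (+ 0)) → RelationViaU
    s≈-r   : Vanishes (offset (+ 1) (+ 1) (+ 0)) → RelationViaU
    s+k≈r  : Vanishes (offset (- + 1) (+ 1) (+ 1)) → RelationViaU
    s+k≈-r : Vanishes (offset (+ 1) (+ 1) (+ 1)) → RelationViaU
    2s≈r   : Vanishes (offset (- + 1) (+ 2) (+ 0)) → RelationViaU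
    2s≈-r  : Vanishes (offset (+ 1) (+ 2) (+ 0)) → RelationViaU
    s+k≈0  : Vanishes (offset (+ 0) (+ 1) (+ 1)) → RelationViaU

  data RelationViaV : Set where
    2s≈r  : Vanishes (offset (- + 1) (+ 2) (+ 0)) → RelationViaV
    2s≈-r : Vanishes (offset (+ 1) (+ 2) (+ 0)) → RelationViaV
    3s≈0  : Vanishes (offset (+ 0) (+ 3) (+ 0)) → RelationViaV
    4s≈0  : Vanishes (offset (+ 0) (+ 4) (+ 0)) → RelationViaV
    5s≈0  : Vanishes (offset (+ 0) (+ 5) (+ 0)) → RelationViaV
    6s≈0  : Vanishes (offset (+ 0) (+ 6) (+ 0)) → RelationViaV

  -- The information carried by a loop v_i y … z v_i (W never neighbours v_i).
  LoopRelation : Vx → Vx → Set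
  LoopRelation (U , _) _       = RelationViaU
  LoopRelation (V , _) (U , _) = RelationViaU
  LoopRelation (V , _) (V , _) = RelationViaV
  LoopRelation (V , _) (W , _) = ⊤
  LoopRelation (W , _) _       = ⊤

  private
    with-2k : ∀ {v} → Vanishes v → Vanishes (v ⊞ offset (+ 0) (+ 0) (+ 2))
    with-2k z = vanishes-⊞ z vanishes-2k

  loop3 : ∀ {i x1 x2} → Edge (V , i) x1 → Edge x1 x2 → Edge x2 (V , i) →
          (x2 ≢ (V , i)) → ((V , i) ≢ x1) → (x1 ≢ x2) → LoopRelation x1 x2
  loop3 v-u u-v _ n₁ _ _ = ⊥-elim (n₁ refl)
  loop3 (v-v⁺ _) v-u u-v _ n₂ _ = ⊥-elim (n₂ refl)
  loop3 (v-v⁺ d1) (v-v⁺ d2) (v-v⁺ d3) _ _ _ = 3s≈0 (gap-loop (d1 ⨾ d2 ⨾ d3))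
  loop3 (v-v⁺ _) (v-v⁺ d2) (v-v⁻ d3) _ n₂ _ = ⊥-elim (n₂ (same V (d2 ⨾ d3)))
  loop3 (v-v⁺ d1) (v-v⁻ d2) _ n₁ _ _ = ⊥-elim (n₁ (same V (d1 ⨾ d2)))
  loop3 (v-v⁻ _) v-u u-v _ n₂ _ = ⊥-elim (n₂ refl)
  loop3 (v-v⁻ d1) (v-v⁺ d2) _ n₁ _ _ = ⊥-elim (n₁ (same V (d1 ⨾ d2)))
  loop3 (v-v⁻ _) (v-v⁻ d2) (v-v⁺ d3) _ n₂ _ = ⊥-elim (n₂ (same V (d2 ⨾ d3)))
  loop3 (v-v⁻ d1) (v-v⁻ d2) (v-v⁻ d3) _ _ _ = 3s≈0 (vanishes-⊟ (gap-loop (d1 ⨾ d2 ⨾ d3)))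

  loop4 : ∀ {i x1 x2 x3} → Edge (V , i) x1 → Edge x1 x2 → Edge x2 x3 → Edge x3 (V , i) →
          (x2 ≢ (V , i)) → (x3 ≢ x1) → ((V , i) ≢ x2) → (x1 ≢ x3) → LoopRelation x1 x3
  loop4 v-u u-v _ _ n₁ _ _ _ = ⊥-elim (n₁ refl)
  loop4 v-u u-w w-u _ _ n₂ _ _ = ⊥-elim (n₂ refl)
  loop4 v-u u-w (w-uʳ _) u-v _ _ _ n₄ = ⊥-elim (n₄ refl)
  loop4 v-u (u-wʳ _) w-u u-v _ _ _ n₄ = ⊥-elim (n₄ refl)
  loop4 v-u (u-wʳ d2) (w-uʳ d3) _ _ n₂ _ _ = ⊥-elim (n₂ (same U (d2 ⨾ d3)))
  loop4 (v-v⁺ _) v-u u-v _ _ n₂ _ _ = ⊥-elim (n₂ refl)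
  loop4 (v-v⁺ _) (v-v⁺ _) v-u u-v _ _ n₃ _ = ⊥-elim (n₃ refl)
  loop4 (v-v⁺ d1) (v-v⁺ d2) (v-v⁺ d3) (v-v⁺ d4) _ _ _ _ = 4s≈0 (gap-loop (d1 ⨾ d2 ⨾ d3 ⨾ d4))
  loop4 (v-v⁺ _) (v-v⁺ _) (v-v⁺ d3) (v-v⁻ d4) _ _ n₃ _ = ⊥-elim (n₃ (same V (d3 ⨾ d4)))
  loop4 (v-v⁺ _) (v-v⁺ d2) (v-v⁻ d3) _ _ n₂ _ _ = ⊥-elim (n₂ (same V (d2 ⨾ d3)))
  loop4 (v-v⁺ d1) (v-v⁻ d2) _ _ n₁ _ _ _ = ⊥-elim (n₁ (same V (d1 ⨾ d2)))
  loop4 (v-v⁻ _) v-u u-v _ _ n₂ _ _ = ⊥-elim (n₂ refl)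
  loop4 (v-v⁻ d1) (v-v⁺ d2) _ _ n₁ _ _ _ = ⊥-elim (n₁ (same V (d1 ⨾ d2)))
  loop4 (v-v⁻ _) (v-v⁻ _) v-u u-v _ _ n₃ _ = ⊥-elim (n₃ refl)
  loop4 (v-v⁻ _) (v-v⁻ d2) (v-v⁺ d3) _ _ n₂ _ _ = ⊥-elim (n₂ (same V (d2 ⨾ d3)))
  loop4 (v-v⁻ _) (v-v⁻ _) (v-v⁻ d3) (v-v⁺ d4) _ _ n₃ _ = ⊥-elim (n₃ (same V (d3 ⨾ d4)))
  loop4 (v-v⁻ d1) (v-v⁻ d2) (v-v⁻ d3) (v-v⁻ d4) _ _ _ _ = 4s≈0 (vanishes-⊟ (gap-loop (d1 ⨾ d2 ⨾ d3 ⨾ d4)))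

  loop5 : ∀ {i x1 x2 x3 x4} → Edge (V , i) x1 → Edge x1 x2 → Edge x2 x3 → Edge x3 x4 → Edge x4 (V , i) →
          (x2 ≢ (V , i)) → (x3 ≢ x1) → (x4 ≢ x2) → ((V , i) ≢ x3) → (x1 ≢ x4) → LoopRelation x1 x4
  loop5 v-u u-v _ _ _ n₁ _ _ _ _ = ⊥-elim (n₁ refl)
  loop5 v-u u-w w-u _ _ _ n₂ _ _ _ = ⊥-elim (n₂ refl)
  loop5 v-u u-w (w-uʳ d3) u-v (v-v⁺ d5) _ _ _ _ _ = s≈r (gap-loop (d3 ⨾ d5))
  loop5 v-u u-w (w-uʳ d3) u-v (v-v⁻ d5) _ _ _ _ _ = s≈-r (vanishes-⊟ (gap-loop (d3 ⨾ d5)))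
  loop5 v-u u-w (w-uʳ d3) (u-wʳ d4) _ _ _ n₃ _ _ = ⊥-elim (n₃ (same W (d3 ⨾ d4)))
  loop5 v-u u-w (w-w _) w-u u-v _ _ _ _ n₅ = ⊥-elim (n₅ refl)
  loop5 v-u u-w (w-w _) (w-uʳ _) u-v _ _ _ _ n₅ = ⊥-elim (n₅ refl)
  loop5 v-u u-w (w-w d3) (w-w d4) _ _ _ n₃ _ _ = ⊥-elim (n₃ (same₂ₖ W (d3 ⨾ d4)))
  loop5 v-u (u-wʳ d2) w-u u-v (v-v⁺ d5) _ _ _ _ _ = s≈-r (gap-loop (d2 ⨾ d5))
  loop5 v-u (u-wʳ d2) w-u u-v (v-v⁻ d5) _ _ _ _ _ = s≈r (vanishes-⊟ (gap-loop (d2 ⨾ d5)))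
  loop5 v-u (u-wʳ _) w-u u-w _ _ _ n₃ _ _ = ⊥-elim (n₃ refl)
  loop5 v-u (u-wʳ d2) (w-uʳ d3) _ _ _ n₂ _ _ _ = ⊥-elim (n₂ (same U (d2 ⨾ d3)))
  loop5 v-u (u-wʳ _) (w-w _) w-u u-v _ _ _ _ n₅ = ⊥-elim (n₅ refl)
  loop5 v-u (u-wʳ _) (w-w _) (w-uʳ _) u-v _ _ _ _ n₅ = ⊥-elim (n₅ refl)
  loop5 v-u (u-wʳ _) (w-w d3) (w-w d4) _ _ _ n₃ _ _ = ⊥-elim (n₃ (same₂ₖ W (d3 ⨾ d4)))
  loop5 (v-v⁺ _) v-u u-v _ _ _ n₂ _ _ _ = ⊥-elim (n₂ refl)
  loop5 (v-v⁺ _) v-u u-w w-u _ _ _ n₃ _ _ = ⊥-elim (n₃ refl)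
  loop5 (v-v⁺ d1) v-u u-w (w-uʳ d4) u-v _ _ _ _ _ = s≈r (gap-loop (d1 ⨾ d4))
  loop5 (v-v⁺ d1) v-u (u-wʳ d3) w-u u-v _ _ _ _ _ = s≈-r (gap-loop (d1 ⨾ d3))
  loop5 (v-v⁺ _) v-u (u-wʳ d3) (w-uʳ d4) _ _ _ n₃ _ _ = ⊥-elim (n₃ (same U (d3 ⨾ d4)))
  loop5 (v-v⁺ _) (v-v⁺ _) v-u u-v _ _ _ n₃ _ _ = ⊥-elim (n₃ refl)
  loop5 (v-v⁺ _) (v-v⁺ _) (v-v⁺ _) v-u u-v _ _ _ n₄ _ = ⊥-elim (n₄ refl)
  loop5 (v-v⁺ d1) (v-v⁺ d2) (v-v⁺ d3) (v-v⁺ d4) (v-v⁺ d5) _ _ _ _ _ = 5s≈0 (gap-loop (d1 ⨾ d2 ⨾ d3 ⨾ d4 ⨾ d5))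
  loop5 (v-v⁺ _) (v-v⁺ _) (v-v⁺ _) (v-v⁺ d4) (v-v⁻ d5) _ _ _ n₄ _ = ⊥-elim (n₄ (same V (d4 ⨾ d5)))
  loop5 (v-v⁺ _) (v-v⁺ _) (v-v⁺ d3) (v-v⁻ d4) _ _ _ n₃ _ _ = ⊥-elim (n₃ (same V (d3 ⨾ d4)))
  loop5 (v-v⁺ _) (v-v⁺ d2) (v-v⁻ d3) _ _ _ n₂ _ _ _ = ⊥-elim (n₂ (same V (d2 ⨾ d3)))
  loop5 (v-v⁺ d1) (v-v⁻ d2) _ _ _ n₁ _ _ _ _ = ⊥-elim (n₁ (same V (d1 ⨾ d2)))
  loop5 (v-v⁻ _) v-u u-v _ _ _ n₂ _ _ _ = ⊥-elim (n₂ refl)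
  loop5 (v-v⁻ _) v-u u-w w-u _ _ _ n₃ _ _ = ⊥-elim (n₃ refl)
  loop5 (v-v⁻ d1) v-u u-w (w-uʳ d4) u-v _ _ _ _ _ = s≈-r (vanishes-⊟ (gap-loop (d1 ⨾ d4)))
  loop5 (v-v⁻ d1) v-u (u-wʳ d3) w-u u-v _ _ _ _ _ = s≈r (vanishes-⊟ (gap-loop (d1 ⨾ d3)))
  loop5 (v-v⁻ _) v-u (u-wʳ d3) (w-uʳ d4) _ _ _ n₃ _ _ = ⊥-elim (n₃ (same U (d3 ⨾ d4)))
  loop5 (v-v⁻ d1) (v-v⁺ d2) _ _ _ n₁ _ _ _ _ = ⊥-elim (n₁ (same V (d1 ⨾ d2)))
  loop5 (v-v⁻ _) (v-v⁻ _) v-u u-v _ _ _ n₃ _ _ = ⊥-elim (n₃ refl)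
  loop5 (v-v⁻ _) (v-v⁻ d2) (v-v⁺ d3) _ _ _ n₂ _ _ _ = ⊥-elim (n₂ (same V (d2 ⨾ d3)))
  loop5 (v-v⁻ _) (v-v⁻ _) (v-v⁻ _) v-u u-v _ _ _ n₄ _ = ⊥-elim (n₄ refl)
  loop5 (v-v⁻ _) (v-v⁻ _) (v-v⁻ d3) (v-v⁺ d4) _ _ _ n₃ _ _ = ⊥-elim (n₃ (same V (d3 ⨾ d4)))
  loop5 (v-v⁻ _) (v-v⁻ _) (v-v⁻ _) (v-v⁻ d4) (v-v⁺ d5) _ _ _ n₄ _ = ⊥-elim (n₄ (same V (d4 ⨾ d5)))
  loop5 (v-v⁻ d1) (v-v⁻ d2) (v-v⁻ d3) (v-v⁻ d4) (v-v⁻ d5) _ _ _ _ _ = 5s≈0 (vanishes-⊟ (gap-loop (d1 ⨾ d2 ⨾ d3 ⨾ d4 ⨾ d5)))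

  loop6-via-u : ∀ {i x2 x3 x4 x5} → Edge (U , i) x2 → Edge x2 x3 → Edge x3 x4 → Edge x4 x5 → Edge x5 (V , i) →
                (x2 ≢ (V , i)) → (x3 ≢ (U , i)) → (x4 ≢ x2) → (x5 ≢ x3) → ((V , i) ≢ x4) → ((U , i) ≢ x5) →
                RelationViaU
  loop6-via-u u-v _ _ _ _ n₁ _ _ _ _ _ = ⊥-elim (n₁ refl)
  loop6-via-u u-w w-u _ _ _ _ n₂ _ _ _ _ = ⊥-elim (n₂ refl)
  loop6-via-u u-w (w-uʳ _) u-v v-u _ _ _ _ n₄ _ _ = ⊥-elim (n₄ refl)
  loop6-via-u u-w (w-uʳ d3) u-v (v-v⁺ d5) (v-v⁺ d6) _ _ _ _ _ _ = 2s≈r (gap-loop (d3 ⨾ d5 ⨾ d6))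
  loop6-via-u u-w (w-uʳ _) u-v (v-v⁺ d5) (v-v⁻ d6) _ _ _ _ n₅ _ = ⊥-elim (n₅ (same V (d5 ⨾ d6)))
  loop6-via-u u-w (w-uʳ _) u-v (v-v⁻ d5) (v-v⁺ d6) _ _ _ _ n₅ _ = ⊥-elim (n₅ (same V (d5 ⨾ d6)))
  loop6-via-u u-w (w-uʳ d3) u-v (v-v⁻ d5) (v-v⁻ d6) _ _ _ _ _ _ = 2s≈-r (vanishes-⊟ (gap-loop (d3 ⨾ d5 ⨾ d6)))
  loop6-via-u u-w (w-uʳ _) u-w w-u _ _ _ _ n₄ _ _ = ⊥-elim (n₄ refl)
  loop6-via-u u-w (w-uʳ _) u-w (w-uʳ _) u-v _ _ _ _ _ n₆ = ⊥-elim (n₆ refl)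
  loop6-via-u u-w (w-uʳ d3) (u-wʳ d4) _ _ _ _ n₃ _ _ _ = ⊥-elim (n₃ (same W (d3 ⨾ d4)))
  loop6-via-u u-w (w-w d3) w-u u-v (v-v⁺ d6) _ _ _ _ _ _ = s+k≈0 (gap-loop (d3 ⨾ d6))
  loop6-via-u u-w (w-w d3) w-u u-v (v-v⁻ d6) _ _ _ _ _ _ = s+k≈0 (with-2k (vanishes-⊟ (gap-loop (d3 ⨾ d6))))
  loop6-via-u u-w (w-w _) w-u u-w _ _ _ _ n₄ _ _ = ⊥-elim (n₄ refl)
  loop6-via-u u-w (w-w d3) (w-uʳ d4) u-v (v-v⁺ d6) _ _ _ _ _ _ = s+k≈r (gap-loop (d3 ⨾ d4 ⨾ d6))
  loop6-via-u u-w (w-w d3) (w-uʳ d4) u-v (v-v⁻ d6) _ _ _ _ _ _ = s+k≈-r (with-2k (vanishes-⊟ (gap-loop (d3 ⨾ d4 ⨾ d6))))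
  loop6-via-u u-w (w-w _) (w-uʳ d4) (u-wʳ d5) _ _ _ _ n₄ _ _ = ⊥-elim (n₄ (same W (d4 ⨾ d5)))
  loop6-via-u u-w (w-w d3) (w-w d4) _ _ _ _ n₃ _ _ _ = ⊥-elim (n₃ (same₂ₖ W (d3 ⨾ d4)))
  loop6-via-u (u-wʳ _) w-u u-v v-u _ _ _ _ n₄ _ _ = ⊥-elim (n₄ refl)
  loop6-via-u (u-wʳ d2) w-u u-v (v-v⁺ d5) (v-v⁺ d6) _ _ _ _ _ _ = 2s≈-r (gap-loop (d2 ⨾ d5 ⨾ d6))
  loop6-via-u (u-wʳ _) w-u u-v (v-v⁺ d5) (v-v⁻ d6) _ _ _ _ n₅ _ = ⊥-elim (n₅ (same V (d5 ⨾ d6)))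
  loop6-via-u (u-wʳ _) w-u u-v (v-v⁻ d5) (v-v⁺ d6) _ _ _ _ n₅ _ = ⊥-elim (n₅ (same V (d5 ⨾ d6)))
  loop6-via-u (u-wʳ d2) w-u u-v (v-v⁻ d5) (v-v⁻ d6) _ _ _ _ _ _ = 2s≈r (vanishes-⊟ (gap-loop (d2 ⨾ d5 ⨾ d6)))
  loop6-via-u (u-wʳ _) w-u u-w _ _ _ _ n₃ _ _ _ = ⊥-elim (n₃ refl)
  loop6-via-u (u-wʳ _) w-u (u-wʳ _) w-u u-v _ _ _ _ _ n₆ = ⊥-elim (n₆ refl)
  loop6-via-u (u-wʳ _) w-u (u-wʳ d4) (w-uʳ d5) _ _ _ _ n₄ _ _ = ⊥-elim (n₄ (same U (d4 ⨾ d5)))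
  loop6-via-u (u-wʳ d2) (w-uʳ d3) _ _ _ _ n₂ _ _ _ _ = ⊥-elim (n₂ (same U (d2 ⨾ d3)))
  loop6-via-u (u-wʳ d2) (w-w d3) w-u u-v (v-v⁺ d6) _ _ _ _ _ _ = s+k≈-r (gap-loop (d2 ⨾ d3 ⨾ d6))
  loop6-via-u (u-wʳ d2) (w-w d3) w-u u-v (v-v⁻ d6) _ _ _ _ _ _ = s+k≈r (with-2k (vanishes-⊟ (gap-loop (d2 ⨾ d3 ⨾ d6))))
  loop6-via-u (u-wʳ _) (w-w _) w-u u-w _ _ _ _ n₄ _ _ = ⊥-elim (n₄ refl)
  loop6-via-u (u-wʳ d2) (w-w d3) (w-uʳ d4) u-v (v-v⁺ d6) _ _ _ _ _ _ = s+k≈0 (gap-loop (d2 ⨾ d3 ⨾ d4 ⨾ d6))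
  loop6-via-u (u-wʳ d2) (w-w d3) (w-uʳ d4) u-v (v-v⁻ d6) _ _ _ _ _ _ = s+k≈0 (with-2k (vanishes-⊟ (gap-loop (d2 ⨾ d3 ⨾ d4 ⨾ d6))))
  loop6-via-u (u-wʳ _) (w-w _) (w-uʳ d4) (u-wʳ d5) _ _ _ _ n₄ _ _ = ⊥-elim (n₄ (same W (d4 ⨾ d5)))
  loop6-via-u (u-wʳ _) (w-w d3) (w-w d4) _ _ _ _ n₃ _ _ _ = ⊥-elim (n₃ (same₂ₖ W (d3 ⨾ d4)))

  loop6-via-v⁺ : ∀ {i j x2 x3 x4 x5} → Gap i j s⁺ → Edge (V , j) x2 → Edge x2 x3 → Edge x3 x4 → Edge x4 x5 →
                 Edge x5 (V , i) → (x2 ≢ (V , i)) → (x3 ≢ (V , j)) → (x4 ≢ x2) → (x5 ≢ x3) → ((V , i) ≢ x4) →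
                 ((V , j) ≢ x5) → LoopRelation (V , j) x5
  loop6-via-v⁺ _ v-u u-v _ _ _ _ n₂ _ _ _ _ = ⊥-elim (n₂ refl)
  loop6-via-v⁺ _ v-u u-w w-u _ _ _ _ n₃ _ _ _ = ⊥-elim (n₃ refl)
  loop6-via-v⁺ d1 v-u u-w (w-uʳ d4) u-v (v-v⁺ d6) _ _ _ _ _ _ = 2s≈r (gap-loop (d1 ⨾ d4 ⨾ d6))
  loop6-via-v⁺ d1 v-u u-w (w-uʳ _) u-v (v-v⁻ d6) _ _ _ _ _ n₆ = ⊥-elim (n₆ (same V (d6 ⨾ d1)))
  loop6-via-v⁺ _ v-u u-w (w-uʳ d4) (u-wʳ d5) _ _ _ _ n₄ _ _ = ⊥-elim (n₄ (same W (d4 ⨾ d5)))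
  loop6-via-v⁺ d1 v-u u-w (w-w d4) w-u u-v _ _ _ _ _ _ = s+k≈0 (gap-loop (d1 ⨾ d4))
  loop6-via-v⁺ d1 v-u u-w (w-w d4) (w-uʳ d5) u-v _ _ _ _ _ _ = s+k≈r (gap-loop (d1 ⨾ d4 ⨾ d5))
  loop6-via-v⁺ _ v-u u-w (w-w d4) (w-w d5) _ _ _ _ n₄ _ _ = ⊥-elim (n₄ (same₂ₖ W (d4 ⨾ d5)))
  loop6-via-v⁺ d1 v-u (u-wʳ d3) w-u u-v (v-v⁺ d6) _ _ _ _ _ _ = 2s≈-r (gap-loop (d1 ⨾ d3 ⨾ d6))
  loop6-via-v⁺ d1 v-u (u-wʳ _) w-u u-v (v-v⁻ d6) _ _ _ _ _ n₆ = ⊥-elim (n₆ (same V (d6 ⨾ d1)))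
  loop6-via-v⁺ _ v-u (u-wʳ _) w-u u-w _ _ _ _ n₄ _ _ = ⊥-elim (n₄ refl)
  loop6-via-v⁺ _ v-u (u-wʳ d3) (w-uʳ d4) _ _ _ _ n₃ _ _ _ = ⊥-elim (n₃ (same U (d3 ⨾ d4)))
  loop6-via-v⁺ d1 v-u (u-wʳ d3) (w-w d4) w-u u-v _ _ _ _ _ _ = s+k≈-r (gap-loop (d1 ⨾ d3 ⨾ d4))
  loop6-via-v⁺ d1 v-u (u-wʳ d3) (w-w d4) (w-uʳ d5) u-v _ _ _ _ _ _ = s+k≈0 (gap-loop (d1 ⨾ d3 ⨾ d4 ⨾ d5))
  loop6-via-v⁺ _ v-u (u-wʳ _) (w-w d4) (w-w d5) _ _ _ _ n₄ _ _ = ⊥-elim (n₄ (same₂ₖ W (d4 ⨾ d5)))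
  loop6-via-v⁺ _ (v-v⁺ _) v-u u-v _ _ _ _ n₃ _ _ _ = ⊥-elim (n₃ refl)
  loop6-via-v⁺ _ (v-v⁺ _) v-u u-w w-u _ _ _ _ n₄ _ _ = ⊥-elim (n₄ refl)
  loop6-via-v⁺ d1 (v-v⁺ d2) v-u u-w (w-uʳ d5) u-v _ _ _ _ _ _ = 2s≈r (gap-loop (d1 ⨾ d2 ⨾ d5))
  loop6-via-v⁺ d1 (v-v⁺ d2) v-u (u-wʳ d4) w-u u-v _ _ _ _ _ _ = 2s≈-r (gap-loop (d1 ⨾ d2 ⨾ d4))
  loop6-via-v⁺ _ (v-v⁺ _) v-u (u-wʳ d4) (w-uʳ d5) _ _ _ _ n₄ _ _ = ⊥-elim (n₄ (same U (d4 ⨾ d5)))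
  loop6-via-v⁺ _ (v-v⁺ _) (v-v⁺ _) v-u u-v _ _ _ _ n₄ _ _ = ⊥-elim (n₄ refl)
  loop6-via-v⁺ _ (v-v⁺ _) (v-v⁺ _) (v-v⁺ _) v-u u-v _ _ _ _ n₅ _ = ⊥-elim (n₅ refl)
  loop6-via-v⁺ d1 (v-v⁺ d2) (v-v⁺ d3) (v-v⁺ d4) (v-v⁺ d5) (v-v⁺ d6) _ _ _ _ _ _ = 6s≈0 (gap-loop (d1 ⨾ d2 ⨾ d3 ⨾ d4 ⨾ d5 ⨾ d6))
  loop6-via-v⁺ _ (v-v⁺ _) (v-v⁺ _) (v-v⁺ _) (v-v⁺ d5) (v-v⁻ d6) _ _ _ _ n₅ _ = ⊥-elim (n₅ (same V (d5 ⨾ d6)))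
  loop6-via-v⁺ _ (v-v⁺ _) (v-v⁺ _) (v-v⁺ d4) (v-v⁻ d5) _ _ _ _ n₄ _ _ = ⊥-elim (n₄ (same V (d4 ⨾ d5)))
  loop6-via-v⁺ _ (v-v⁺ _) (v-v⁺ d3) (v-v⁻ d4) _ _ _ _ n₃ _ _ _ = ⊥-elim (n₃ (same V (d3 ⨾ d4)))
  loop6-via-v⁺ _ (v-v⁺ d2) (v-v⁻ d3) _ _ _ _ n₂ _ _ _ _ = ⊥-elim (n₂ (same V (d2 ⨾ d3)))
  loop6-via-v⁺ d1 (v-v⁻ d2) _ _ _ _ n₁ _ _ _ _ _ = ⊥-elim (n₁ (same V (d1 ⨾ d2)))

  loop6-via-v⁻ : ∀ {i j x2 x3 x4 x5} → Gap i j s⁻ → Edge (V , j) x2 → Edge x2 x3 → Edge x3 x4 → Edge x4 x5 →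
                 Edge x5 (V , i) → (x2 ≢ (V , i)) → (x3 ≢ (V , j)) → (x4 ≢ x2) → (x5 ≢ x3) → ((V , i) ≢ x4) →
                 ((V , j) ≢ x5) → LoopRelation (V , j) x5
  loop6-via-v⁻ _ v-u u-v _ _ _ _ n₂ _ _ _ _ = ⊥-elim (n₂ refl)
  loop6-via-v⁻ _ v-u u-w w-u _ _ _ _ n₃ _ _ _ = ⊥-elim (n₃ refl)
  loop6-via-v⁻ d1 v-u u-w (w-uʳ _) u-v (v-v⁺ d6) _ _ _ _ _ n₆ = ⊥-elim (n₆ (same V (d6 ⨾ d1)))
  loop6-via-v⁻ d1 v-u u-w (w-uʳ d4) u-v (v-v⁻ d6) _ _ _ _ _ _ = 2s≈-r (vanishes-⊟ (gap-loop (d1 ⨾ d4 ⨾ d6)))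
  loop6-via-v⁻ _ v-u u-w (w-uʳ d4) (u-wʳ d5) _ _ _ _ n₄ _ _ = ⊥-elim (n₄ (same W (d4 ⨾ d5)))
  loop6-via-v⁻ d1 v-u u-w (w-w d4) w-u u-v _ _ _ _ _ _ = s+k≈0 (with-2k (vanishes-⊟ (gap-loop (d1 ⨾ d4))))
  loop6-via-v⁻ d1 v-u u-w (w-w d4) (w-uʳ d5) u-v _ _ _ _ _ _ = s+k≈-r (with-2k (vanishes-⊟ (gap-loop (d1 ⨾ d4 ⨾ d5))))
  loop6-via-v⁻ _ v-u u-w (w-w d4) (w-w d5) _ _ _ _ n₄ _ _ = ⊥-elim (n₄ (same₂ₖ W (d4 ⨾ d5)))
  loop6-via-v⁻ d1 v-u (u-wʳ _) w-u u-v (v-v⁺ d6) _ _ _ _ _ n₆ = ⊥-elim (n₆ (same V (d6 ⨾ d1)))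
  loop6-via-v⁻ d1 v-u (u-wʳ d3) w-u u-v (v-v⁻ d6) _ _ _ _ _ _ = 2s≈r (vanishes-⊟ (gap-loop (d1 ⨾ d3 ⨾ d6)))
  loop6-via-v⁻ _ v-u (u-wʳ _) w-u u-w _ _ _ _ n₄ _ _ = ⊥-elim (n₄ refl)
  loop6-via-v⁻ _ v-u (u-wʳ d3) (w-uʳ d4) _ _ _ _ n₃ _ _ _ = ⊥-elim (n₃ (same U (d3 ⨾ d4)))
  loop6-via-v⁻ d1 v-u (u-wʳ d3) (w-w d4) w-u u-v _ _ _ _ _ _ = s+k≈r (with-2k (vanishes-⊟ (gap-loop (d1 ⨾ d3 ⨾ d4))))
  loop6-via-v⁻ d1 v-u (u-wʳ d3) (w-w d4) (w-uʳ d5) u-v _ _ _ _ _ _ = s+k≈0 (with-2k (vanishes-⊟ (gap-loop (d1 ⨾ d3 ⨾ d4 ⨾ d5))))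
  loop6-via-v⁻ _ v-u (u-wʳ _) (w-w d4) (w-w d5) _ _ _ _ n₄ _ _ = ⊥-elim (n₄ (same₂ₖ W (d4 ⨾ d5)))
  loop6-via-v⁻ d1 (v-v⁺ d2) _ _ _ _ n₁ _ _ _ _ _ = ⊥-elim (n₁ (same V (d1 ⨾ d2)))
  loop6-via-v⁻ _ (v-v⁻ _) v-u u-v _ _ _ _ n₃ _ _ _ = ⊥-elim (n₃ refl)
  loop6-via-v⁻ _ (v-v⁻ _) v-u u-w w-u _ _ _ _ n₄ _ _ = ⊥-elim (n₄ refl)
  loop6-via-v⁻ d1 (v-v⁻ d2) v-u u-w (w-uʳ d5) u-v _ _ _ _ _ _ = 2s≈-r (vanishes-⊟ (gap-loop (d1 ⨾ d2 ⨾ d5)))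
  loop6-via-v⁻ d1 (v-v⁻ d2) v-u (u-wʳ d4) w-u u-v _ _ _ _ _ _ = 2s≈r (vanishes-⊟ (gap-loop (d1 ⨾ d2 ⨾ d4)))
  loop6-via-v⁻ _ (v-v⁻ _) v-u (u-wʳ d4) (w-uʳ d5) _ _ _ _ n₄ _ _ = ⊥-elim (n₄ (same U (d4 ⨾ d5)))
  loop6-via-v⁻ _ (v-v⁻ d2) (v-v⁺ d3) _ _ _ _ n₂ _ _ _ _ = ⊥-elim (n₂ (same V (d2 ⨾ d3)))
  loop6-via-v⁻ _ (v-v⁻ _) (v-v⁻ _) v-u u-v _ _ _ _ n₄ _ _ = ⊥-elim (n₄ refl)
  loop6-via-v⁻ _ (v-v⁻ _) (v-v⁻ d3) (v-v⁺ d4) _ _ _ _ n₃ _ _ _ = ⊥-elim (n₃ (same V (d3 ⨾ d4)))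
  loop6-via-v⁻ _ (v-v⁻ _) (v-v⁻ _) (v-v⁻ _) v-u u-v _ _ _ _ n₅ _ = ⊥-elim (n₅ refl)
  loop6-via-v⁻ _ (v-v⁻ _) (v-v⁻ _) (v-v⁻ d4) (v-v⁺ d5) _ _ _ _ n₄ _ _ = ⊥-elim (n₄ (same V (d4 ⨾ d5)))
  loop6-via-v⁻ _ (v-v⁻ _) (v-v⁻ _) (v-v⁻ _) (v-v⁻ d5) (v-v⁺ d6) _ _ _ _ n₅ _ = ⊥-elim (n₅ (same V (d5 ⨾ d6)))
  loop6-via-v⁻ d1 (v-v⁻ d2) (v-v⁻ d3) (v-v⁻ d4) (v-v⁻ d5) (v-v⁻ d6) _ _ _ _ _ _ = 6s≈0 (vanishes-⊟ (gap-loop (d1 ⨾ d2 ⨾ d3 ⨾ d4 ⨾ d5 ⨾ d6)))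

  loop6 : ∀ {i x1 x2 x3 x4 x5} → Edge (V , i) x1 → Edge x1 x2 → Edge x2 x3 → Edge x3 x4 → Edge x4 x5 → Edge x5 (V , i) →
          (x2 ≢ (V , i)) → (x3 ≢ x1) → (x4 ≢ x2) → (x5 ≢ x3) → ((V , i) ≢ x4) → (x1 ≢ x5) → LoopRelation x1 x5
  loop6 v-u = loop6-via-u
  loop6 (v-v⁺ g) = loop6-via-v⁺ g
  loop6 (v-v⁻ g) = loop6-via-v⁻ g

  angle-at-v : ∀ {i y z} → Angle (V , i) y z → LoopRelation y z
  angle-at-v (inj₁ (a1 , a2 , a3 , n1 , n2 , n3)) =
    loop3 (edge-view a1) (edge-view a2) (edge-view a3) n1 n2 n3
  angle-at-v (inj₂ (inj₁ (_ , a1 , a2 , a3 , a4 , n1 , n2 , n3 , n4))) =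
    loop4 (edge-view a1) (edge-view a2) (edge-view a3) (edge-view a4) n1 n2 n3 n4
  angle-at-v (inj₂ (inj₂ (inj₁ (_ , _ , a1 , a2 , a3 , a4 , a5 , n1 , n2 , n3 , n4 , n5)))) =
    loop5 (edge-view a1) (edge-view a2) (edge-view a3) (edge-view a4) (edge-view a5) n1 n2 n3 n4 n5
  angle-at-v (inj₂ (inj₂ (inj₂ (_ , _ , _ , a1 , a2 , a3 , a4 , a5 , a6 , n1 , n2 , n3 , n4 , n5 , n6)))) =
    loop6 (edge-view a1) (edge-view a2) (edge-view a3) (edge-view a4) (edge-view a5) (edge-view a6)
          n1 n2 n3 n4 n5 n6

  data SideStep (i j : Ix) : Set where
    plus  : Gap i j s⁺ → SideStep i j
    minus : Gap i j s⁻ → SideStep i j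

  data NeighbourOfV (i : Ix) : Vx → Set where
    via-u : NeighbourOfV i (U , i)
    via-v : ∀ {j} → SideStep i j → NeighbourOfV i (V , j)

  out-neighbour : ∀ {i y} → Edge (V , i) y → NeighbourOfV i y
  out-neighbour v-u = via-u
  out-neighbour (v-v⁺ g) = via-v (plus g)
  out-neighbour (v-v⁻ g) = via-v (minus g)

  in-neighbour : ∀ {i y} → Edge y (V , i) → NeighbourOfV i y
  in-neighbour u-v = via-u
  in-neighbour (v-v⁺ g) = via-v (minus (gap-sym g))
  in-neighbour (v-v⁻ g) = via-v (plus (gap-sym g))

  -- v_i has only two V-neighbours.
  pigeonhole : ∀ {i j l m} → SideStep i j → SideStep i l → SideStep i m →
               _≢_ {A = Vx} (V , j) (V , l) → _≢_ {A = Vx} (V , l) (V , m) → _≢_ {A = Vx} (V , m) (V , j) → ⊥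
  pigeonhole (plus a)  (plus b)  _         n _ _ = n (cong (V ,_) (gap-functional a b))
  pigeonhole (minus a) (minus b) _         n _ _ = n (cong (V ,_) (gap-functional a b))
  pigeonhole (plus a)  (minus b) (plus c)  _ _ n = n (cong (V ,_) (gap-functional c a))
  pigeonhole (plus a)  (minus b) (minus c) _ n _ = n (cong (V ,_) (gap-functional b c))
  pigeonhole (minus a) (plus b)  (plus c)  _ n _ = n (cong (V ,_) (gap-functional b c))
  pigeonhole (minus a) (plus b)  (minus c) _ _ n = n (cong (V ,_) (gap-functional c a))

  -- Two angles at v_i with a common arm: one of the three arms is u_i.
  two-angles-at-v : ∀ {i} → TwoAngles (V , i) → RelationViaU
  two-angles-at-v (y , z , t , z≢t , a₁ , a₂) =
    pick (out-neighbour (edge-view (angle-first a₁))) (in-neighbour (edge-view (angle-last a₁)))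
         (in-neighbour (edge-view (angle-last a₂))) (angle-at-v a₁) (angle-at-v a₂)
         (λ e → angle-arms a₁ (sym e)) z≢t (angle-arms a₂)
    where
    pick : ∀ {i y z t} → NeighbourOfV i y → NeighbourOfV i z → NeighbourOfV i t →
           LoopRelation y z → LoopRelation y t → y ≢ z → z ≢ t → t ≢ y → RelationViaU
    pick via-u _ _ o _ _ _ _ = o
    pick (via-v _) via-u _ o _ _ _ _ = o
    pick (via-v _) (via-v _) via-u _ o _ _ _ = o
    pick (via-v a) (via-v b) (via-v c) _ _ n₁ n₂ n₃ = ⊥-elim (pigeonhole a b c n₁ n₂ n₃)

  -- Three pairwise angles at v_i: exactly one arm is u_i, and the other two form a V–V angle.
  three-angles-at-v : ∀ {i} → ThreeAngles (V , i) → RelationViaV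
  three-angles-at-v (y , z , t , y≢z , z≢t , t≢y , a₁ , a₂ , a₃) =
    pick (first a₁) (first a₂) (first a₃) (angle-at-v a₁) (angle-at-v a₂) (angle-at-v a₃) y≢z z≢t t≢y
    where
    first : ∀ {i y z} → Angle (V , i) y z → NeighbourOfV i y
    first a = out-neighbour (edge-view (angle-first a))
    pick : ∀ {i y z t} → NeighbourOfV i y → NeighbourOfV i z → NeighbourOfV i t →
           LoopRelation y z → LoopRelation z t → LoopRelation t y → y ≢ z → z ≢ t → t ≢ y → RelationViaV
    pick via-u via-u _ _ _ _ n _ _ = ⊥-elim (n refl)
    pick via-u _ via-u _ _ _ _ _ n = ⊥-elim (n refl)
    pick _ via-u via-u _ _ _ _ n _ = ⊥-elim (n refl)
    pick via-u (via-v _) (via-v _) _ o _ _ _ _ = o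
    pick (via-v _) via-u (via-v _) _ _ o _ _ _ = o
    pick (via-v _) (via-v _) via-u o _ _ _ _ _ = o
    pick (via-v a) (via-v b) (via-v c) _ _ _ n₁ n₂ n₃ = ⊥-elim (pigeonhole a b c n₁ n₂ n₃)

-- The walks never
-- backtrack because r ≢ 0; the relations s ≡ ±r (+ k) create the extra short
-- loops making the three arms at u pairwise angles.
module Witnesses (k′ : ℕ) (r s : ℤ₂ (suc k′)) (r≉0 : ¬ T2.Vanishes k′ r s r⁺) where
  open T2 k′ r s

  ix : ℕ → ℕ → ℕ → Ix
  ix a b c = Fin.zero ⊕ (a ℕ.* toℕ r ℕ.+ b ℕ.* toℕ s ℕ.+ c ℕ.* K)

  from-0 : ∀ a b c → Gap Fin.zero (ix a b c) (offset (+ a) (+ b) (+ c))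
  from-0 a b c = shift Fin.zero _ _ (trans (ℤP.pos-+ (a ℕ.* toℕ r ℕ.+ b ℕ.* toℕ s) _)
    (cong₂ _+_ (trans (ℤP.pos-+ (a ℕ.* toℕ r) _) (cong₂ _+_ (ℤP.pos-* a _) (ℤP.pos-* b _))) (ℤP.pos-* c _)))

  between : ∀ a b c a′ b′ c′ → Gap (ix a b c) (ix a′ b′ c′) (⊟ offset (+ a) (+ b) (+ c) ⊞ offset (+ a′) (+ b′) (+ c′))
  between a b c a′ b′ c′ = gap-sym (from-0 a b c) ⨾ from-0 a′ b′ c′

  private
    r≉0′ : ¬ Vanishes r⁻
    r≉0′ z = r≉0 (vanishes-⊟ z)

  two-angles-at-w : TwoAngles (W , ix 1 0 0)
  two-angles-at-w = (W , ix 1 0 1) , (U , ix 0 0 0) , (U , ix 1 0 2) ,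
    apart (between 1 0 2 0 0 0 ⊞₀ vanishes-2k) r≉0′ , loop₁ , loop₂
    where
    -- w_r w_{r+k} u_k w_k w_{2k} u_0
    loop₁ : Angle (W , ix 1 0 0) (W , ix 1 0 1) (U , ix 0 0 0)
    loop₁ = angle6
      ( edge-adj (w-w (between 1 0 0 1 0 1))
      , edge-adj (w-uʳ (between 1 0 1 0 0 1))
      , edge-adj u-w
      , edge-adj (w-w (between 0 0 1 0 0 2))
      , adj-wu (between 0 0 2 0 0 0 ⊞₀ vanishes-2k)
      , edge-adj (u-wʳ (between 0 0 0 1 0 0))
      , (λ ()) , apart (between 1 0 1 0 0 1) r≉0′ , (λ ()) , (λ ()) , apart (between 0 0 2 1 0 0 ⊞₀ vanishes-2k) r≉0 , (λ ())
      )
    -- w_r w_{r+k} u_{r+k} w_{2r+k} w_{2r+2k} u_{r+2k}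
    loop₂ : Angle (W , ix 1 0 0) (W , ix 1 0 1) (U , ix 1 0 2)
    loop₂ = angle6
      ( edge-adj (w-w (between 1 0 0 1 0 1))
      , edge-adj w-u
      , edge-adj (u-wʳ (between 1 0 1 2 0 1))
      , edge-adj (w-w (between 2 0 1 2 0 2))
      , edge-adj (w-uʳ (between 2 0 2 1 0 2))
      , adj-uw (between 1 0 2 1 0 0 ⊞₀ vanishes-2k)
      , (λ ()) , apart (between 1 0 1 2 0 1) r≉0 , (λ ()) , (λ ()) , apart (between 2 0 2 1 0 0 ⊞₀ vanishes-2k) r≉0′ , (λ ())
      )

  three-angles-if-s≈r : Vanishes (offset (- + 1) (+ 1) (+ 0)) → ThreeAngles (U , ix 0 1 0)
  three-angles-if-s≈r h = (V , ix 0 1 0) , (W , ix 0 1 0) , (W , ix 1 1 0) ,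
    (λ ()) , apart (between 1 1 0 0 1 0) r≉0′ , (λ ()) , loop₁ , loop₂ , loop₃
    where
    -- u_s v_s v_0 u_0 w_s
    loop₁ : Angle (U , ix 0 1 0) (V , ix 0 1 0) (W , ix 0 1 0)
    loop₁ = angle5
      ( edge-adj u-v
      , edge-adj (v-v⁻ (between 0 1 0 0 0 0))
      , edge-adj v-u
      , edge-adj (u-wʳ (between 0 0 0 0 1 0 ⊞₀ (vanishes-⊟ h)))
      , edge-adj w-u
      , (λ ()) , (λ ()) , (λ ()) , apart (between 0 0 0 0 1 0 ⊞₀ (vanishes-⊟ h)) r≉0 , (λ ())
      )
    -- u_s w_s w_{s+k} u_{s+k} w_{r+s+k} w_{r+s}
    loop₂ : Angle (U , ix 0 1 0) (W , ix 0 1 0) (W , ix 1 1 0)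
    loop₂ = angle6
      ( edge-adj u-w
      , edge-adj (w-w (between 0 1 0 0 1 1))
      , edge-adj w-u
      , edge-adj (u-wʳ (between 0 1 1 1 1 1))
      , edge-adj (w-w (between 1 1 1 1 1 0 ⊞₀ vanishes-2k))
      , edge-adj (w-uʳ (between 1 1 0 0 1 0))
      , (λ ()) , (λ ()) , apart (between 0 1 1 1 1 1) r≉0 , (λ ()) , (λ ()) , apart (between 1 1 0 0 1 0) r≉0′
      )
    -- u_s w_{r+s} u_{r+s} v_{r+s} v_s
    loop₃ : Angle (U , ix 0 1 0) (W , ix 1 1 0) (V , ix 0 1 0)
    loop₃ = angle5
      ( edge-adj (u-wʳ (between 0 1 0 1 1 0))
      , edge-adj w-u
      , edge-adj u-v
      , edge-adj (v-v⁻ (between 1 1 0 0 1 0 ⊞₀ (vanishes-⊟ h)))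
      , edge-adj v-u
      , apart (between 0 1 0 1 1 0) r≉0 , (λ ()) , (λ ()) , (λ ()) , (λ ())
      )

  three-angles-if-s≈-r : Vanishes (offset (+ 1) (+ 1) (+ 0)) → ThreeAngles (U , ix 0 0 0)
  three-angles-if-s≈-r h = (W , ix 0 0 0) , (W , ix 1 0 0) , (V , ix 0 0 0) ,
    apart (between 1 0 0 0 0 0) r≉0′ , (λ ()) , (λ ()) , loop₁ , loop₂ , loop₃
    where
    -- u_0 w_0 w_k u_k w_{r+k} w_r
    loop₁ : Angle (U , ix 0 0 0) (W , ix 0 0 0) (W , ix 1 0 0)
    loop₁ = angle6
      ( edge-adj u-w
      , edge-adj (w-w (between 0 0 0 0 0 1))
      , edge-adj w-u
      , edge-adj (u-wʳ (between 0 0 1 1 0 1))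
      , edge-adj (w-w (between 1 0 1 1 0 0 ⊞₀ vanishes-2k))
      , edge-adj (w-uʳ (between 1 0 0 0 0 0))
      , (λ ()) , (λ ()) , apart (between 0 0 1 1 0 1) r≉0 , (λ ()) , (λ ()) , apart (between 1 0 0 0 0 0) r≉0′
      )
    -- u_0 w_r u_r v_r v_0
    loop₂ : Angle (U , ix 0 0 0) (W , ix 1 0 0) (V , ix 0 0 0)
    loop₂ = angle5
      ( edge-adj (u-wʳ (between 0 0 0 1 0 0))
      , edge-adj w-u
      , edge-adj u-v
      , edge-adj (v-v⁺ (between 1 0 0 0 0 0 ⊞₀ h))
      , edge-adj v-u
      , apart (between 0 0 0 1 0 0) r≉0 , (λ ()) , (λ ()) , (λ ()) , (λ ())
      )
    -- u_0 v_0 v_s u_s w_0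
    loop₃ : Angle (U , ix 0 0 0) (V , ix 0 0 0) (W , ix 0 0 0)
    loop₃ = angle5
      ( edge-adj u-v
      , edge-adj (v-v⁺ (between 0 0 0 0 1 0))
      , edge-adj v-u
      , edge-adj (u-wʳ (between 0 1 0 0 0 0 ⊞₀ h))
      , edge-adj w-u
      , (λ ()) , (λ ()) , (λ ()) , apart (between 0 1 0 0 0 0 ⊞₀ h) r≉0 , (λ ())
      )

  three-angles-if-s+k≈r : Vanishes (offset (- + 1) (+ 1) (+ 1)) → ThreeAngles (U , ix 1 0 0)
  three-angles-if-s+k≈r h = (W , ix 1 0 0) , (W , ix 2 0 0) , (V , ix 1 0 0) ,
    apart (between 2 0 0 1 0 0) r≉0′ , (λ ()) , (λ ()) , loop₁ , loop₂ , loop₃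
    where
    -- u_r w_r w_{r+k} u_{r+k} w_{2r+k} w_{2r}
    loop₁ : Angle (U , ix 1 0 0) (W , ix 1 0 0) (W , ix 2 0 0)
    loop₁ = angle6
      ( edge-adj u-w
      , edge-adj (w-w (between 1 0 0 1 0 1))
      , edge-adj w-u
      , edge-adj (u-wʳ (between 1 0 1 2 0 1))
      , edge-adj (w-w (between 2 0 1 2 0 0 ⊞₀ vanishes-2k))
      , edge-adj (w-uʳ (between 2 0 0 1 0 0))
      , (λ ()) , (λ ()) , apart (between 1 0 1 2 0 1) r≉0 , (λ ()) , (λ ()) , apart (between 2 0 0 1 0 0) r≉0′
      )
    -- u_r w_{2r} w_{2r+k} u_{2r+k} v_{2r+k} v_r
    loop₂ : Angle (U , ix 1 0 0) (W , ix 2 0 0) (V , ix 1 0 0)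
    loop₂ = angle6
      ( edge-adj (u-wʳ (between 1 0 0 2 0 0))
      , edge-adj (w-w (between 2 0 0 2 0 1))
      , edge-adj w-u
      , edge-adj u-v
      , edge-adj (v-v⁻ (between 2 0 1 1 0 0 ⊞₀ (vanishes-⊟ h) ⊞₀ vanishes-2k))
      , edge-adj v-u
      , (λ ()) , (λ ()) , (λ ()) , (λ ()) , (λ ()) , (λ ())
      )
    -- u_r v_r v_k u_k w_{r+k} w_r
    loop₃ : Angle (U , ix 1 0 0) (V , ix 1 0 0) (W , ix 1 0 0)
    loop₃ = angle6
      ( edge-adj u-v
      , edge-adj (v-v⁻ (between 1 0 0 0 0 1 ⊞₀ (vanishes-⊟ h)))
      , edge-adj v-u
      , edge-adj (u-wʳ (between 0 0 1 1 0 1))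
      , edge-adj (w-w (between 1 0 1 1 0 0 ⊞₀ vanishes-2k))
      , edge-adj w-u
      , (λ ()) , (λ ()) , (λ ()) , (λ ()) , (λ ()) , (λ ())
      )

  three-angles-if-s+k≈-r : Vanishes (offset (+ 1) (+ 1) (+ 1)) → ThreeAngles (U , ix 1 0 0)
  three-angles-if-s+k≈-r h = (W , ix 1 0 0) , (W , ix 2 0 0) , (V , ix 1 0 0) ,
    apart (between 2 0 0 1 0 0) r≉0′ , (λ ()) , (λ ()) , loop₁ , loop₂ , loop₃
    where
    -- u_r w_r w_{r+k} u_{r+k} w_{2r+k} w_{2r}
    loop₁ : Angle (U , ix 1 0 0) (W , ix 1 0 0) (W , ix 2 0 0)
    loop₁ = angle6
      ( edge-adj u-w
      , edge-adj (w-w (between 1 0 0 1 0 1))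
      , edge-adj w-u
      , edge-adj (u-wʳ (between 1 0 1 2 0 1))
      , edge-adj (w-w (between 2 0 1 2 0 0 ⊞₀ vanishes-2k))
      , edge-adj (w-uʳ (between 2 0 0 1 0 0))
      , (λ ()) , (λ ()) , apart (between 1 0 1 2 0 1) r≉0 , (λ ()) , (λ ()) , apart (between 2 0 0 1 0 0) r≉0′
      )
    -- u_r w_{2r} w_{2r+k} u_{2r+k} v_{2r+k} v_r
    loop₂ : Angle (U , ix 1 0 0) (W , ix 2 0 0) (V , ix 1 0 0)
    loop₂ = angle6
      ( edge-adj (u-wʳ (between 1 0 0 2 0 0))
      , edge-adj (w-w (between 2 0 0 2 0 1))
      , edge-adj w-u
      , edge-adj u-v
      , edge-adj (v-v⁺ (between 2 0 1 1 0 0 ⊞₀ h))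
      , edge-adj v-u
      , (λ ()) , (λ ()) , (λ ()) , (λ ()) , (λ ()) , (λ ())
      )
    -- u_r v_r v_k u_k w_{r+k} w_r
    loop₃ : Angle (U , ix 1 0 0) (V , ix 1 0 0) (W , ix 1 0 0)
    loop₃ = angle6
      ( edge-adj u-v
      , edge-adj (v-v⁺ (between 1 0 0 0 0 1 ⊞₀ h ⊞₀ (vanishes-⊟ vanishes-2k)))
      , edge-adj v-u
      , edge-adj (u-wʳ (between 0 0 1 1 0 1))
      , edge-adj (w-w (between 1 0 1 1 0 0 ⊞₀ vanishes-2k))
      , edge-adj w-u
      , (λ ()) , (λ ()) , (λ ()) , (λ ()) , (λ ()) , (λ ())
      )

-- If K ∣ p·x for a prime p with 2p ≤ K, then K and x share a divisor d ≥ 2: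
-- d = K when p ∤ K (p is then coprime to K), and d = K/p otherwise.
prime-multiple : ∀ {K p} (x : ℤ) → Prime p → 2 ℕ.* p ℕ.≤ K → + K ∣ + p * x →
                 ∃ λ d → 2 ℕ.≤ d × d ℕD.∣ K × + d ∣ x
prime-multiple {K} {p} x pp 2p≤K K∣px with p ℕD.∣? K
... | yes (ℕD.divides q K≡qp) = q , 2≤q , ℕD.divides p (trans K≡qp (ℕP.*-comm q p)) , q∣x
  where
  instance _ = prime⇒nonZero pp
  2≤q : 2 ℕ.≤ q
  2≤q = ℕP.*-cancelʳ-≤ 2 q p (subst (2 ℕ.* p ℕ.≤_) K≡qp 2p≤K)
  q∣x : + q ∣ x
  q∣x = *-cancelˡ-∣ (+ p) (subst (_∣ + p * x) (trans (cong +_ K≡qp) (trans (ℤP.pos-* q p) (ℤP.*-comm (+ q) (+ p)))) K∣px)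
... | no p∤K = K , ℕP.≤-trans (ℕP.m≤m*n 2 p) 2p≤K , ℕD.∣-refl ,
               ∣ᵤ⇒∣ (coprime-divisor coprime (subst (K ℕD.∣_) (ℤP.abs-* (+ p) x) (∣⇒∣ᵤ K∣px)))
  where
  instance _ = prime⇒nonZero pp
  coprime : Coprime K p
  coprime (d∣K , d∣p) with prime⇒irreducible pp d∣p
  ... | inj₁ d≡1 = d≡1
  ... | inj₂ refl = ⊥-elim (p∤K d∣K)

-- For odd K, K ∣ 2·x implies K ∣ x, because 2 · (m + 1) = 1 + K when K = 2m + 1.
halve : ∀ {K} (x : ℤ) → Odd K → + K ∣ + 2 * x → + K ∣ x
halve {K} x K-odd@(m , _) = cancel-unit (+ 2) (+ m + + 1) (+ 1) x (begin
    + 2 * (+ m + + 1)             ≡⟨ double (+ m) ⟩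
    + 1 + + 1 * (+ 1 + + 2 * + m) ≡⟨ cong (λ z → + 1 + + 1 * z) (odd-form K-odd) ⟨
    + 1 + + 1 * + K               ∎)
  where
  open ≡-Reasoning
  double : ∀ m → + 2 * (m + + 1) ≡ + 1 + + 1 * (+ 1 + + 2 * m)
  double = solve-∀

module Dependence (k′ : ℕ) (r s : ℤ₂ (suc k′)) where
  open T2 k′ r s

  -- If a·r + b·s + c·k ≡ 0 (mod 2k) with a = ±1, then r ≡ −a(b·s + c·k), so every
  -- common divisor of s and k divides r.
  r-determined : ∀ {b c d} (a : ℤ) → a * a ≡ + 1 → Vanishes (offset a b c) → d ∣ σ → d ∣ κ → d ∣ ρ
  r-determined {b} {c} a a²≡1 (vanishes z) d∣σ d∣κ =
    subst (_ ∣_) solve-r (∣m∣n⇒∣m-n (∣m∣n⇒∣m-n (∣n⇒∣m*n a (∣-trans (∣κ⇒∣N d∣κ) z)) (∣n⇒∣m*n (a * b) d∣σ)) (∣n⇒∣m*n (a * c) d∣κ))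
    where
    open ≡-Reasoning
    expand : ∀ a b c r s k → a * (a * r + b * s + c * k) - a * b * s - a * c * k ≡ (a * a) * r
    expand = solve-∀
    solve-r : a * (a * ρ + b * σ + c * κ) - a * b * σ - a * c * κ ≡ ρ
    solve-r = begin
      a * (a * ρ + b * σ + c * κ) - a * b * σ - a * c * κ ≡⟨ expand a b c ρ σ κ ⟩
      (a * a) * ρ                                         ≡⟨ cong (_* ρ) a²≡1 ⟩
      + 1 * ρ                                             ≡⟨ ℤP.*-identityˡ ρ ⟩
      ρ                                                   ∎

-- For odd k > 9 the relations m·s ≡ 0 (m = 3, …, 6) are impossible once no d ≥ 2
-- divides both s and k: after cancelling the units 2 (k odd) and, when coprime,
-- 3 or 5, such a d arises from prime-multiple.
module SmallOrder (k′ : ℕ) (r s : ℤ₂ (suc k′)) (odd : Odd (suc k′)) (k>9 : 9 ℕ.< suc k′)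
                  (no-shared : ∀ {d} → 2 ℕ.≤ d → d ℕD.∣ suc k′ → + d ∣ + toℕ s → ⊥) where
  open T2 k′ r s

  private
    K∣ms : ∀ m → Vanishes (offset (+ 0) (+ m) (+ 0)) → + K ∣ + m * σ
    K∣ms m (vanishes z) = subst (+ K ∣_) (only-s ρ σ κ (+ m)) (∣-trans K∣N z)
      where
      only-s : ∀ r s k m → + 0 * r + m * s + + 0 * k ≡ m * s
      only-s = solve-∀

    10≤K : 10 ℕ.≤ K
    10≤K = k>9

    6≤K : 2 ℕ.* 3 ℕ.≤ K
    6≤K = ℕP.≤-trans (ℕP.m≤n+m 6 4) 10≤K

    via-prime : ∀ {p} → Prime p → 2 ℕ.* p ℕ.≤ K → + K ∣ + p * σ → ⊥
    via-prime pp 2p≤K K∣pσ with prime-multiple σ pp 2p≤K K∣pσ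
    ... | d , 2≤d , d∣K , d∣σ = no-shared 2≤d d∣K d∣σ

    4≡2·2 : ∀ x → + 4 * x ≡ + 2 * (+ 2 * x)
    4≡2·2 = solve-∀

    6≡2·3 : ∀ x → + 6 * x ≡ + 2 * (+ 3 * x)
    6≡2·3 = solve-∀

  not-3s : ¬ Vanishes (offset (+ 0) (+ 3) (+ 0))
  not-3s z = via-prime (from-yes (prime? 3)) 6≤K (K∣ms 3 z)

  not-4s : ¬ Vanishes (offset (+ 0) (+ 4) (+ 0))
  not-4s z = no-shared (ℕP.≤-trans (ℕP.m≤n+m 2 8) 10≤K) ℕD.∣-refl
    (halve σ odd (halve (+ 2 * σ) odd (subst (+ K ∣_) (4≡2·2 σ) (K∣ms 4 z))))

  not-5s : ¬ Vanishes (offset (+ 0) (+ 5) (+ 0))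
  not-5s z = via-prime (from-yes (prime? 5)) 10≤K (K∣ms 5 z)

  not-6s : ¬ Vanishes (offset (+ 0) (+ 6) (+ 0))
  not-6s z = via-prime (from-yes (prime? 3)) 6≤K
    (halve (+ 3 * σ) odd (subst (+ K ∣_) (6≡2·3 σ) (K∣ms 6 z)))

module Scaling (k′ : ℕ) where
  open Indices k′

  scale : ℤ → Ix → Ix
  scale μ i = fromℕ< (ℤD.n%ℕd<d (μ * ι i) N)

  scale-residue : ∀ μ i → + N ∣ ι (scale μ i) - μ * ι i
  scale-residue μ i = divides (- (μ * ι i ℤD./ℕ N)) (begin
      ι (scale μ i) - μ * ι i                             ≡⟨ cong₂ _-_ (cong +_ (FinP.toℕ-fromℕ< _)) (ℤD.a≡a%ℕn+[a/ℕn]*n (μ * ι i) N) ⟩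
      + (a ℤD.%ℕ N) - (+ (a ℤD.%ℕ N) + (a ℤD./ℕ N) * + N) ≡⟨ cancel (+ (a ℤD.%ℕ N)) (a ℤD./ℕ N) (+ N) ⟩
      - (a ℤD./ℕ N) * + N                                 ∎)
    where
    open ≡-Reasoning
    a = μ * ι i
    cancel : ∀ x q n → x - (x + q * n) ≡ - q * n
    cancel = solve-∀

  scaleᵛ : ℤ → Vx → Vx
  scaleᵛ μ (X , i) = X , scale μ i

  scale-inverse : ∀ μ ν → + N ∣ ν * μ - + 1 → ∀ x → scaleᵛ ν (scaleᵛ μ x) ≡ x
  scale-inverse μ ν νμ≡1 (X , i) = cong (X ,_) (index-unique (subst (+ N ∣_)
      (telescope (ι (scale ν (scale μ i))) (ι (scale μ i)) (ι i) μ ν)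
      (∣m∣n⇒∣m+n (∣m∣n⇒∣m+n (scale-residue ν (scale μ i)) (∣n⇒∣m*n ν (scale-residue μ i)))
                 (subst (+ N ∣_) (ℤP.*-comm (ι i) _) (∣n⇒∣m*n (ι i) νμ≡1)))))
    where
    telescope : ∀ z y x μ ν → (z - ν * y) + ν * (y - μ * x) + (ν * μ - + 1) * x ≡ z - x
    telescope = solve-∀

module ScaledEdges (k′ : ℕ) (r s r′ s′ : ℤ₂ (suc k′)) (μ : ℤ) where
  open Indices k′
  open Scaling k′
  module G = T2 k′ r s
  module H = T2 k′ r′ s′

  transfer : ∀ {i j v w} → + N ∣ μ * G.value v - H.value w → G.Gap i j v → H.Gap (scale μ i) (scale μ j) w
  transfer {i} {j} {v} {w} hv (G.gap g) = H.gap (subst (+ N ∣_)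
      (telescope (ι (scale μ j)) (ι j) (ι (scale μ i)) (ι i) (G.value v) (H.value w) μ)
      (∣m∣n⇒∣m+n (∣m∣n⇒∣m+n (∣m∣n⇒∣m-n (scale-residue μ j) (scale-residue μ i)) (∣n⇒∣m*n μ g)) hv))
    where
    telescope : ∀ y j x i v w μ → (y - μ * j) - (x - μ * i) + μ * (j - i - v) + (μ * v - w) ≡ y - x - w
    telescope = solve-∀

  module _ (hr : + N ∣ μ * G.ρ - H.ρ) (hs : (+ N ∣ μ * G.σ - H.σ) ⊎ (+ N ∣ μ * G.σ + H.σ))
           (hk : + N ∣ μ * κ - κ) where

    transfer-offset : ∀ a b c b′ → + N ∣ μ * (b * G.σ) - b′ * H.σ →
                      + N ∣ μ * G.value (offset a b c) - H.value (offset a b′ c)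
    transfer-offset a b c b′ hb = subst (+ N ∣_) (sym (split a b c b′ G.ρ G.σ H.ρ H.σ κ μ))
      (∣m∣n⇒∣m+n (∣m∣n⇒∣m+n (∣n⇒∣m*n a hr) hb) (∣n⇒∣m*n c hk))
      where
      split : ∀ a b c b′ r s r′ s′ k μ → μ * (a * r + b * s + c * k) - (a * r′ + b′ * s′ + c * k)
              ≡ a * (μ * r - r′) + (μ * (b * s) - b′ * s′) + c * (μ * k - k)
      split = solve-∀

    private
      no-s : + N ∣ μ * (+ 0 * G.σ) - + 0 * H.σ
      no-s = subst (+ N ∣_) (sym (vanish μ G.σ H.σ)) (divides (+ 0) refl)
        where
        vanish : ∀ μ s s′ → μ * (+ 0 * s) - + 0 * s′ ≡ + 0
        vanish = solve-∀

      same-s : ∀ b → + N ∣ μ * G.σ - H.σ → + N ∣ μ * (b * G.σ) - b * H.σ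
      same-s b h = subst (+ N ∣_) (factor b μ G.σ H.σ) (∣n⇒∣m*n b h)
        where
        factor : ∀ b μ s s′ → b * (μ * s - s′) ≡ μ * (b * s) - b * s′
        factor = solve-∀

      flip-s : ∀ b → + N ∣ μ * G.σ + H.σ → + N ∣ μ * (b * G.σ) - (- b) * H.σ
      flip-s b h = subst (+ N ∣_) (factor b μ G.σ H.σ) (∣n⇒∣m*n b h)
        where
        factor : ∀ b μ s s′ → b * (μ * s + s′) ≡ μ * (b * s) - (- b) * s′
        factor = solve-∀

    scale-edge : ∀ {x y} → G.Edge x y → H.Adjacent (scaleᵛ μ x) (scaleᵛ μ y)
    scale-edge G.u-v = H.edge-adj H.u-v
    scale-edge G.u-w = H.edge-adj H.u-w
    scale-edge G.v-u = H.edge-adj H.v-u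
    scale-edge G.w-u = H.edge-adj H.w-u
    scale-edge (G.u-wʳ g) = H.edge-adj (H.u-wʳ (transfer (transfer-offset (+ 1) (+ 0) (+ 0) (+ 0) no-s) g))
    scale-edge (G.w-uʳ g) = H.edge-adj (H.w-uʳ (transfer (transfer-offset (- + 1) (+ 0) (+ 0) (+ 0) no-s) g))
    scale-edge (G.w-w g) = H.edge-adj (H.w-w (transfer (transfer-offset (+ 0) (+ 0) (+ 1) (+ 0) no-s) g))
    scale-edge (G.v-v⁺ g) = side⁺ hs g
      where
      side⁺ : ∀ {i j} → (+ N ∣ μ * G.σ - H.σ) ⊎ (+ N ∣ μ * G.σ + H.σ) → G.Gap i j s⁺ →
              H.Adjacent (V , scale μ i) (V , scale μ j)
      side⁺ (inj₁ h) g = H.edge-adj (H.v-v⁺ (transfer (transfer-offset (+ 0) (+ 1) (+ 0) (+ 1) (same-s (+ 1) h)) g))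
      side⁺ (inj₂ h) g = H.edge-adj (H.v-v⁻ (transfer (transfer-offset (+ 0) (+ 1) (+ 0) (- + 1) (flip-s (+ 1) h)) g))
    scale-edge (G.v-v⁻ g) = side⁻ hs g
      where
      side⁻ : ∀ {i j} → (+ N ∣ μ * G.σ - H.σ) ⊎ (+ N ∣ μ * G.σ + H.σ) → G.Gap i j s⁻ →
              H.Adjacent (V , scale μ i) (V , scale μ j)
      side⁻ (inj₁ h) g = H.edge-adj (H.v-v⁻ (transfer (transfer-offset (+ 0) (- + 1) (+ 0) (- + 1) (same-s (- + 1) h)) g))
      side⁻ (inj₂ h) g = H.edge-adj (H.v-v⁺ (transfer (transfer-offset (+ 0) (- + 1) (+ 0) (+ 1) (flip-s (- + 1) h)) g))

    scale-adj : ∀ {x y} → G.Adjacent x y → H.Adjacent (scaleᵛ μ x) (scaleᵛ μ y)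
    scale-adj a = scale-edge (G.edge-view a)

-- Multiplication by a unit μ of ℤ_N (ν·μ ≡ 1) with μ·r ≡ r′, μ·s ≡ ±s′ and
-- μ·k ≡ k is an isomorphism T₂(k,r,s) ≅ T₂(k,r′,s′); its inverse, scaling by ν,
-- satisfies the same conditions in the other direction.
module ScalingIso (k′ : ℕ) (r s r′ s′ : ℤ₂ (suc k′)) where
  open Indices k′
  open Scaling k′

  private
    undo : ∀ μ ν a b → + N ∣ ν * μ - + 1 → + N ∣ μ * a - b → + N ∣ ν * b - a
    undo μ ν a b u h = subst (+ N ∣_) (rearrange μ ν a b) (∣m∣n⇒∣m-n (∣m⇒∣m*n a u) (∣n⇒∣m*n ν h))
      where
      rearrange : ∀ μ ν a b → (ν * μ - + 1) * a - ν * (μ * a - b) ≡ ν * b - a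
      rearrange = solve-∀

    undo⁺ : ∀ μ ν a b → + N ∣ ν * μ - + 1 → + N ∣ μ * a + b → + N ∣ ν * b + a
    undo⁺ μ ν a b u h = subst (+ N ∣_) (rearrange μ ν a b) (∣m∣n⇒∣m-n (∣n⇒∣m*n ν h) (∣m⇒∣m*n a u))
      where
      rearrange : ∀ μ ν a b → ν * (μ * a + b) - (ν * μ - + 1) * a ≡ ν * b + a
      rearrange = solve-∀

  scaling-iso : (μ ν : ℤ) → + N ∣ ν * μ - + 1 → + N ∣ μ * ι r - ι r′ →
                ((+ N ∣ μ * ι s - ι s′) ⊎ (+ N ∣ μ * ι s + ι s′)) → + N ∣ μ * κ - κ →
                Isomorphic K r s r′ s′
  scaling-iso μ ν νμ≡1 hr hs hk = scaleᵛ μ , onto , injective , preserves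
    where
    μν≡1 : + N ∣ μ * ν - + 1
    μν≡1 = subst (λ z → + N ∣ z - + 1) (ℤP.*-comm ν μ) νμ≡1
    forward : ∀ {x y} → Adj K r s x y → Adj K r′ s′ (scaleᵛ μ x) (scaleᵛ μ y)
    forward = ScaledEdges.scale-adj k′ r s r′ s′ μ hr hs hk
    backward : ∀ {x y} → Adj K r′ s′ x y → Adj K r s (scaleᵛ ν x) (scaleᵛ ν y)
    backward = ScaledEdges.scale-adj k′ r′ s′ r s ν (undo μ ν (ι r) (ι r′) νμ≡1 hr)
      ([ (λ h → inj₁ (undo μ ν (ι s) (ι s′) νμ≡1 h)) , (λ h → inj₂ (undo⁺ μ ν (ι s) (ι s′) νμ≡1 h)) ]′ hs)
      (undo μ ν κ κ νμ≡1 hk)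
    onto : ∀ y → ∃ λ x → scaleᵛ μ x ≡ y
    onto y = scaleᵛ ν y , scale-inverse ν μ μν≡1 y
    injective : ∀ x y → scaleᵛ μ x ≡ scaleᵛ μ y → x ≡ y
    injective x y e = trans (sym (scale-inverse μ ν νμ≡1 x)) (trans (cong (scaleᵛ ν) e) (scale-inverse μ ν νμ≡1 y))
    preserves : ∀ x y → Adj K r s x y ⇔ Adj K r′ s′ (scaleᵛ μ x) (scaleᵛ μ y)
    preserves x y = mk⇔ forward
      (λ a → subst₂ (Adj K r s) (scale-inverse μ ν νμ≡1 x) (scale-inverse μ ν νμ≡1 y) (backward a))

module WalkTally (k′ : ℕ) (r s : ℤ₂ (suc k′)) where
  open T2 k′ r s

  record Tally : Set where
    constructor tally
    field
      r-net s-net : ℤ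
      #uw #uv #vv #ww : ℕ
  open Tally public

  infixr 5 _⊕ᵗ_
  _⊕ᵗ_ : Tally → Tally → Tally
  t ⊕ᵗ t′ = tally (r-net t + r-net t′) (s-net t + s-net t′)
                  (#uw t ℕ.+ #uw t′) (#uv t ℕ.+ #uv t′) (#vv t ℕ.+ #vv t′) (#ww t ℕ.+ #ww t′)

  edge-tally : ∀ {x y} → Edge x y → Tally
  edge-tally u-v      = tally (+ 0) (+ 0) 0 1 0 0
  edge-tally v-u      = tally (+ 0) (+ 0) 0 1 0 0
  edge-tally u-w      = tally (+ 0) (+ 0) 1 0 0 0
  edge-tally w-u      = tally (+ 0) (+ 0) 1 0 0 0
  edge-tally (u-wʳ _) = tally (+ 1) (+ 0) 1 0 0 0
  edge-tally (w-uʳ _) = tally (- + 1) (+ 0) 1 0 0 0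
  edge-tally (v-v⁺ _) = tally (+ 0) (+ 1) 0 0 1 0
  edge-tally (v-v⁻ _) = tally (+ 0) (- + 1) 0 0 1 0
  edge-tally (w-w _)  = tally (+ 0) (+ 0) 0 0 0 1

  walk-tally : ∀ {n x y} → Walk n x y → Tally
  walk-tally [] = tally (+ 0) (+ 0) 0 0 0 0
  walk-tally (a ∷ w) = edge-tally (edge-view a) ⊕ᵗ walk-tally w

  -- φ changes by ±1 exactly along U–W edges once 2·(r-multiple) is added;
  -- χ indicates the U-vertices.
  φ χ : Vx → ℤ
  φ (U , _) = + 1
  φ (V , _) = + 1
  φ (W , _) = + 0
  χ (U , _) = + 1
  χ (V , _) = + 0
  χ (W , _) = + 0

  NotV : Vx → Set
  NotV (U , _) = ⊤
  NotV (V , _) = ⊥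
  NotV (W , _) = ⊤

  private
    edge-count : ∀ {x y} (e : Edge x y) → let t = edge-tally e in #uw t ℕ.+ #uv t ℕ.+ #vv t ℕ.+ #ww t ≡ 1
    edge-count u-v      = refl
    edge-count v-u      = refl
    edge-count u-w      = refl
    edge-count w-u      = refl
    edge-count (u-wʳ _) = refl
    edge-count (w-uʳ _) = refl
    edge-count (v-v⁺ _) = refl
    edge-count (v-v⁻ _) = refl
    edge-count (w-w _)  = refl

    edge-s : ∀ {x y} (e : Edge x y) → let t = edge-tally e in s-net t ≡ + #vv t ⊎ s-net t ≡ - + #vv t
    edge-s u-v      = inj₁ refl
    edge-s v-u      = inj₁ refl
    edge-s u-w      = inj₁ refl
    edge-s w-u      = inj₁ refl
    edge-s (u-wʳ _) = inj₁ refl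
    edge-s (w-uʳ _) = inj₁ refl
    edge-s (v-v⁺ _) = inj₁ refl
    edge-s (v-v⁻ _) = inj₂ refl
    edge-s (w-w _)  = inj₁ refl

    edge-φ : ∀ {x y} (e : Edge x y) → let t = edge-tally e in
             + 2 * r-net t + φ y - φ x ≡ + #uw t ⊎ + 2 * r-net t + φ y - φ x ≡ - + #uw t
    edge-φ u-v      = inj₁ refl
    edge-φ v-u      = inj₁ refl
    edge-φ u-w      = inj₂ refl
    edge-φ w-u      = inj₁ refl
    edge-φ (u-wʳ _) = inj₁ refl
    edge-φ (w-uʳ _) = inj₂ refl
    edge-φ (v-v⁺ _) = inj₁ refl
    edge-φ (v-v⁻ _) = inj₁ refl
    edge-φ (w-w _)  = inj₁ refl

    edge-χ : ∀ {x y} (e : Edge x y) → let t = edge-tally e in + 2 ∣ + #uw t + + #uv t + χ x + χ y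
    edge-χ u-v      = divides (+ 1) refl
    edge-χ v-u      = divides (+ 1) refl
    edge-χ u-w      = divides (+ 1) refl
    edge-χ w-u      = divides (+ 1) refl
    edge-χ (u-wʳ _) = divides (+ 1) refl
    edge-χ (w-uʳ _) = divides (+ 1) refl
    edge-χ (v-v⁺ _) = divides (+ 0) refl
    edge-χ (v-v⁻ _) = divides (+ 0) refl
    edge-χ (w-w _)  = divides (+ 0) refl

    edge-notV : ∀ {x y} (e : Edge x y) → #uv (edge-tally e) ≡ 0 → NotV x → #vv (edge-tally e) ≡ 0 × NotV y
    edge-notV u-v      () _
    edge-notV v-u      _ ()
    edge-notV u-w      _ _ = refl , _
    edge-notV w-u      _ _ = refl , _
    edge-notV (u-wʳ _) _ _ = refl , _
    edge-notV (w-uʳ _) _ _ = refl , _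
    edge-notV (v-v⁺ _) _ ()
    edge-notV (v-v⁻ _) _ ()
    edge-notV (w-w _)  _ _ = refl , _

    edge-gapᵗ : ∀ {x y} (e : Edge x y) → let t = edge-tally e in
                Gap (proj₂ x) (proj₂ y) (offset (r-net t) (s-net t) (+ #ww t))
    edge-gapᵗ u-v      = edge-gap u-v
    edge-gapᵗ v-u      = edge-gap v-u
    edge-gapᵗ u-w      = edge-gap u-w
    edge-gapᵗ w-u      = edge-gap w-u
    edge-gapᵗ (u-wʳ g) = g
    edge-gapᵗ (w-uʳ g) = g
    edge-gapᵗ (v-v⁺ g) = g
    edge-gapᵗ (v-v⁻ g) = g
    edge-gapᵗ (w-w g)  = g

  tally-length : ∀ {n x y} (w : Walk n x y) → let t = walk-tally w in n ≡ #uw t ℕ.+ #uv t ℕ.+ #vv t ℕ.+ #ww t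
  tally-length [] = refl
  tally-length (a ∷ w) = step (edge-view a) {walk-tally w} (tally-length w)
    where
    regroup : ∀ a b c d a′ b′ c′ d′ → (a ℕ.+ b ℕ.+ c ℕ.+ d) ℕ.+ (a′ ℕ.+ b′ ℕ.+ c′ ℕ.+ d′)
              ≡ (a ℕ.+ a′) ℕ.+ (b ℕ.+ b′) ℕ.+ (c ℕ.+ c′) ℕ.+ (d ℕ.+ d′)
    regroup = ℕSolver.solve-∀
    step : ∀ {x y n} (e : Edge x y) {t : Tally} → n ≡ #uw t ℕ.+ #uv t ℕ.+ #vv t ℕ.+ #ww t →
           suc n ≡ #uw (edge-tally e ⊕ᵗ t) ℕ.+ #uv (edge-tally e ⊕ᵗ t) ℕ.+ #vv (edge-tally e ⊕ᵗ t) ℕ.+ #ww (edge-tally e ⊕ᵗ t)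
    step e {t} n≡ = trans (cong₂ ℕ._+_ (sym (edge-count e)) n≡) (regroup (#uw (edge-tally e)) (#uv (edge-tally e)) (#vv (edge-tally e)) (#ww (edge-tally e)) (#uw t) (#uv t) (#vv t) (#ww t))

  tally-gap : ∀ {n x y} (w : Walk n x y) → let t = walk-tally w in
              Gap (proj₂ x) (proj₂ y) (offset (r-net t) (s-net t) (+ #ww t))
  tally-gap [] = gap-refl
  tally-gap (a ∷ w) = edge-gapᵗ (edge-view a) ⨾ tally-gap w

  private
    abs-± : ∀ {a b} → a ≡ b ⊎ a ≡ - b → ∣ a ∣ ≡ ∣ b ∣
    abs-± (inj₁ refl) = refl
    abs-± {b = b} (inj₂ refl) = ℤP.∣-i∣≡∣i∣ b

    even-± : ∀ {a b} → a ≡ b ⊎ a ≡ - b → + 2 ∣ a + b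
    even-± {b = b} (inj₁ refl) = divides b (double b)
      where
      double : ∀ b → b + b ≡ b * + 2
      double = solve-∀
    even-± {b = b} (inj₂ refl) = divides (+ 0) (ℤP.+-inverseˡ b)

    interchange : ∀ a b c d → (a + b) + (c + d) ≡ (a + c) + (b + d)
    interchange = solve-∀

  -- Each V–V edge moves by ±s: |s-net| ≤ #vv and s-net ≡ #vv (mod 2).
  tally-s : ∀ {n x y} (w : Walk n x y) → let t = walk-tally w in
            ∣ s-net t ∣ ℕ.≤ #vv t × + 2 ∣ s-net t + + #vv t
  tally-s [] = z≤n , divides (+ 0) refl
  tally-s (a ∷ w) = step (edge-view a) {walk-tally w} (tally-s w)
    where
    step : ∀ {x y} (e : Edge x y) {t : Tally} → ∣ s-net t ∣ ℕ.≤ #vv t × + 2 ∣ s-net t + + #vv t →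
           let t′ = edge-tally e ⊕ᵗ t in ∣ s-net t′ ∣ ℕ.≤ #vv t′ × + 2 ∣ s-net t′ + + #vv t′
    step e {t} (bound , parity) =
      ℕP.≤-trans (ℤP.∣i+j∣≤∣i∣+∣j∣ (s-net (edge-tally e)) (s-net t)) (ℕP.+-mono-≤ (ℕP.≤-reflexive (abs-± (edge-s e))) bound) ,
      subst (+ 2 ∣_) (interchange (s-net (edge-tally e)) (+ #vv (edge-tally e)) (s-net t) (+ #vv t))
            (∣m∣n⇒∣m+n (even-± (edge-s e)) parity)

  tally-φ : ∀ {n x y} (w : Walk n x y) → let t = walk-tally w in ∣ + 2 * r-net t + φ y - φ x ∣ ℕ.≤ #uw t
  tally-φ {x = x} [] = ℕP.≤-reflexive (cong ∣_∣ (cancel (φ x)))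
    where
    cancel : ∀ p → + 2 * + 0 + p - p ≡ + 0
    cancel = solve-∀
  tally-φ (a ∷ w) = step (edge-view a) {walk-tally w} (tally-φ w)
    where
    step : ∀ {x y z} (e : Edge x y) {t : Tally} → ∣ + 2 * r-net t + φ z - φ y ∣ ℕ.≤ #uw t →
           let t′ = edge-tally e ⊕ᵗ t in ∣ + 2 * r-net t′ + φ z - φ x ∣ ℕ.≤ #uw t′
    step {x} {y} {z} e {t} bound = ℕP.≤-trans (ℕP.≤-reflexive (cong ∣_∣ (split (r-net (edge-tally e)) (r-net t) (φ x) (φ y) (φ z))))
      (ℕP.≤-trans (ℤP.∣i+j∣≤∣i∣+∣j∣ (+ 2 * r-net (edge-tally e) + φ y - φ x) (+ 2 * r-net t + φ z - φ y)) (ℕP.+-mono-≤ (ℕP.≤-reflexive (abs-± (edge-φ e))) bound))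
      where
      split : ∀ a b p q u → + 2 * (a + b) + u - p ≡ (+ 2 * a + q - p) + (+ 2 * b + u - q)
      split = solve-∀

  -- Edges at U enter or leave U: #uw + #uv + χ x + χ y is even.
  tally-χ : ∀ {n x y} (w : Walk n x y) → let t = walk-tally w in + 2 ∣ + #uw t + + #uv t + χ x + χ y
  tally-χ {x = x} [] = divides (χ x) (double (χ x))
    where
    double : ∀ c → + 0 + + 0 + c + c ≡ c * + 2
    double = solve-∀
  tally-χ (a ∷ w) = step (edge-view a) {walk-tally w} (tally-χ w)
    where
    step : ∀ {x y z} (e : Edge x y) {t : Tally} → + 2 ∣ + #uw t + + #uv t + χ y + χ z →
           let t′ = edge-tally e ⊕ᵗ t in + 2 ∣ + #uw t′ + + #uv t′ + χ x + χ z
    step {x} {y} {z} e {t} parity = subst (+ 2 ∣_)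
      (regroup (+ #uw (edge-tally e)) (+ #uv (edge-tally e)) (+ #uw t) (+ #uv t) (χ x) (χ y) (χ z))
      (∣m∣n⇒∣m-n (∣m∣n⇒∣m+n (edge-χ e) parity) (divides (χ y) refl))
      where
      regroup : ∀ a b c d p q u → (a + b + p + q) + (c + d + q + u) - q * + 2 ≡ (a + c) + (b + d) + p + u
      regroup = solve-∀

  tally-notV : ∀ {n x y} (w : Walk n x y) → #uv (walk-tally w) ≡ 0 → NotV x → #vv (walk-tally w) ≡ 0
  tally-notV [] _ _ = refl
  tally-notV {y = z} (_∷_ {y = y} a w) uv≡0 not-v =
    cong₂ ℕ._+_ (proj₁ first) (tally-notV w (ℕP.m+n≡0⇒n≡0 _ uv≡0) (proj₂ first))
    where
    first : #vv (edge-tally (edge-view a)) ≡ 0 × NotV y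
    first = edge-notV (edge-view a) (ℕP.m+n≡0⇒m≡0 _ uv≡0) not-v

parity : ∀ n → (∃ λ q → n ≡ 2 ℕ.* q) ⊎ Odd n
parity zero = inj₁ (0 , refl)
parity (suc n) with parity n
... | inj₁ (q , refl) = inj₂ (q , refl)
... | inj₂ (q , refl) = inj₁ (suc q , cong suc (sym (ℕP.+-suc q (q ℕ.+ 0))))

-- An odd number coprime to K is coprime to 2K: a common divisor divides 2, but 2 ∤ m.
coprime-to-double : ∀ {m K} → Coprime m K → Odd m → Coprime m (K ℕ.+ K)
coprime-to-double {m} {K} cop (q , m≡) {d} (d∣m , d∣2K) = one-or-two (prime⇒irreducible prime[2] d∣2)
  where
  double : ∀ K → K ℕ.+ K ≡ K ℕ.* 2
  double = ℕSolver.solve-∀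
  d∣2 : d ℕD.∣ 2
  d∣2 = coprime-divisor (λ { (e∣d , e∣K) → cop (ℕD.∣-trans e∣d d∣m , e∣K) }) (subst (d ℕD.∣_) (double K) d∣2K)
  one-or-two : d ≡ 1 ⊎ d ≡ 2 → d ≡ 1
  one-or-two (inj₁ d≡1) = d≡1
  one-or-two (inj₂ refl) with ℕD.∣1⇒≡1 (ℕD.∣m+n∣m⇒∣n (subst (2 ℕD.∣_) (trans m≡ (ℕP.+-comm 1 (2 ℕ.* q))) d∣m) (ℕD.m∣m*n q))
  ... | ()

inverse-mod : ∀ {m n} → Coprime m n → ∃ λ c → + n ∣ c * + m - + 1
inverse-mod {m} {n} cop with coprime-Bézout cop
... | Bézout.+- x y eq = + x , divides (+ y) (begin
    + x * + m - + 1          ≡⟨ cong (_- + 1) (sym (ℤP.pos-* x m)) ⟩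
    + (x ℕ.* m) - + 1        ≡⟨ cong (λ z → + z - + 1) (sym eq) ⟩
    + (1 ℕ.+ y ℕ.* n) - + 1  ≡⟨ cong (_- + 1) (trans (ℤP.pos-+ 1 (y ℕ.* n)) (cong (λ z → + 1 + z) (ℤP.pos-* y n))) ⟩
    + 1 + + y * + n - + 1    ≡⟨ cancel (+ y * + n) ⟩
    + y * + n                ∎)
  where
  open ≡-Reasoning
  cancel : ∀ z → + 1 + z - + 1 ≡ z
  cancel = solve-∀
... | Bézout.-+ x y eq = - + x , divides (- + y) (begin
    - + x * + m - + 1        ≡⟨ negate (+ x) (+ m) ⟩
    - (+ 1 + + x * + m)      ≡⟨ cong (λ z → - (+ 1 + z)) (sym (ℤP.pos-* x m)) ⟩
    - + (1 ℕ.+ x ℕ.* m)      ≡⟨ cong (λ z → - + z) eq ⟩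
    - + (y ℕ.* n)            ≡⟨ cong -_ (ℤP.pos-* y n) ⟩
    - (+ y * + n)            ≡⟨ ℤP.neg-distribˡ-* (+ y) (+ n) ⟩
    - + y * + n              ∎)
  where
  open ≡-Reasoning
  negate : ∀ x m → - x * m - + 1 ≡ - (+ 1 + x * m)
  negate = solve-∀

odd-inverse : ∀ {n m} (c : ℤ) → + 2 ∣ + n → + n ∣ c * + m - + 1 → Odd m → + 2 ∣ c - + 1
odd-inverse {n} {m} c 2∣n n∣cm-1 m-odd@(q , _) =
  subst (+ 2 ∣_) (trans (cong (λ z → c * z - + 1 - c * + q * + 2) (odd-form m-odd)) (drop c (+ q)))
        (∣m∣n⇒∣m-n (∣-trans 2∣n n∣cm-1) (divides (c * + q) refl))
  where
  drop : ∀ c q → c * (+ 1 + + 2 * q) - + 1 - c * q * + 2 ≡ c - + 1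
  drop = solve-∀

Unit : ℤ → Set
Unit ε = ε ≡ + 1 ⊎ ε ≡ - + 1

unit-square : ∀ {ε} → Unit ε → ε * ε ≡ + 1
unit-square (inj₁ refl) = refl
unit-square (inj₂ refl) = refl

unit-abs : ∀ {ε} → Unit ε → ∀ x → ∣ ε * x ∣ ≡ ∣ x ∣
unit-abs (inj₁ refl) x = cong ∣_∣ (ℤP.*-identityˡ x)
unit-abs (inj₂ refl) x = trans (cong ∣_∣ (ℤP.-1*i≡-i x)) (ℤP.∣-i∣≡∣i∣ x)

-- If ε·r + 2s ≡ 0 (ε = ±1), s is even, k is odd and s is coprime to k, then no
-- u-vertex lies on a closed walk of odd length L ≤ k.  Such a walk would make
-- P = s-net − 2ε·r-net satisfy P·s + #ww·k ≡ 0 (mod 2k); parity forces #ww even,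
-- hence k ∣ P, while #vv is odd, hence P is odd and some U–V edge is used, so
-- 0 < |P| ≤ #vv + #uw < L ≤ k: impossible.
module NoOddLoopAtU (k′ : ℕ) (r s : ℤ₂ (suc k′)) (ε : ℤ) (unit : Unit ε)
                    (r≈∓2s : T2.Vanishes k′ r s (offset ε (+ 2) (+ 0)))
                    (s-even : + 2 ∣ + toℕ s) (k-odd : Odd (suc k′)) (coprime : Coprime (suc k′) (toℕ s)) where
  open T2 k′ r s
  open WalkTally k′ r s

  private
    2∤1 : ¬ (+ 2 ∣ + 1)
    2∤1 = one-not-multiple (s≤s (s≤s z≤n))

    r≈-2εs : ∀ {e} → Unit e → Vanishes (offset e (+ 2) (+ 0)) → + N ∣ ρ + + 2 * e * σ
    r≈-2εs (inj₁ refl) (vanishes z) = subst (+ N ∣_) (solve-r ρ σ κ) z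
      where
      solve-r : ∀ r s k → + 1 * r + + 2 * s + + 0 * k ≡ r + + 2 * + 1 * s
      solve-r = solve-∀
    r≈-2εs (inj₂ refl) (vanishes z) = subst (+ N ∣_) (solve-r ρ σ κ) (∣m⇒∣-m z)
      where
      solve-r : ∀ r s k → - (- + 1 * r + + 2 * s + + 0 * k) ≡ r + + 2 * - + 1 * s
      solve-r = solve-∀

  module Loop {L i} (w : Walk L (U , i) (U , i)) (L-odd : Odd L) (L≤K : L ℕ.≤ K) where
    t : Tally
    t = walk-tally w

    P : ℤ
    P = s-net t - + 2 * ε * r-net t

    closes : + N ∣ P * σ + + #ww t * κ
    closes = subst (+ N ∣_) (eliminate-r (r-net t) (s-net t) (+ #ww t) ρ σ κ ε)
      (∣m∣n⇒∣m-n (multiple (gap-loop (tally-gap w))) (∣n⇒∣m*n (r-net t) (r≈-2εs unit r≈∓2s)))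
      where
      eliminate-r : ∀ R S W r s k ε → R * r + S * s + W * k - R * (r + + 2 * ε * s) ≡ (S - + 2 * ε * R) * s + W * k
      eliminate-r = solve-∀

    -- #ww is even, since s is even and k is odd.
    ww-even : + 2 ∣ + #ww t
    ww-even = subst (+ 2 ∣_) (drop-k (+ #ww t) (+ proj₁ k-odd))
      (∣m∣n⇒∣m-n (subst (λ z → + 2 ∣ + #ww t * z) (odd-form k-odd) ww-k-even) (divides (+ #ww t * + proj₁ k-odd) refl))
      where
      ww-k-even : + 2 ∣ + #ww t * κ
      ww-k-even = subst (+ 2 ∣_) (cancel (P * σ) (+ #ww t * κ)) (∣m∣n⇒∣m-n (∣-trans 2∣N closes) (∣n⇒∣m*n P s-even))
        where
        cancel : ∀ a b → a + b - a ≡ b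
        cancel = solve-∀
      drop-k : ∀ w m → w * (+ 1 + + 2 * m) - w * m * + 2 ≡ w
      drop-k = solve-∀

    ww-vanishes : + N ∣ + #ww t * κ
    ww-vanishes = times-k ww-even
      where
      double : ∀ q k → q * + 2 * k ≡ q * (k + k)
      double = solve-∀
      times-k : + 2 ∣ + #ww t → + N ∣ + #ww t * κ
      times-k (divides q ww≡) = divides q (trans (cong (_* κ) ww≡) (double q κ))

    K∣P : K ℕD.∣ ∣ P ∣
    K∣P = coprime-divisor coprime (subst (K ℕD.∣_) (trans (ℤP.abs-* P σ) (ℕP.*-comm ∣ P ∣ (toℕ s)))
      (∣⇒∣ᵤ (∣-trans K∣N (subst (+ N ∣_) (cancel (P * σ) (+ #ww t * κ)) (∣m∣n⇒∣m-n closes ww-vanishes)))))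
      where
      cancel : ∀ a b → a + b - b ≡ a
      cancel = solve-∀

    L-1-even : + 2 ∣ + L - + 1
    L-1-even = divides (+ proj₁ L-odd) (trans (cong (_- + 1) (odd-form L-odd)) (drop-one (+ proj₁ L-odd)))
      where
      drop-one : ∀ m → + 1 + + 2 * m - + 1 ≡ m * + 2
      drop-one = solve-∀

    -- Edges at U come in pairs on a loop at u_i.
    uwuv-even : + 2 ∣ + #uw t + + #uv t
    uwuv-even = subst (+ 2 ∣_) (drop-two (+ #uw t) (+ #uv t)) (∣m∣n⇒∣m-n (tally-χ w) (divides (+ 1) refl))
      where
      drop-two : ∀ a b → a + b + + 1 + + 1 - + 1 * + 2 ≡ a + b
      drop-two = solve-∀

    -- L = #uw + #uv + #vv + #ww is odd, so #vv is odd.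
    vv-odd : + 2 ∣ + #vv t - + 1
    vv-odd = subst (+ 2 ∣_) (trans (cong (λ z → z - + 1 - (+ #uw t + + #uv t) - + #ww t) (cong +_ (tally-length w)))
                                   (isolate (+ #uw t) (+ #uv t) (+ #vv t) (+ #ww t)))
      (∣m∣n⇒∣m-n (∣m∣n⇒∣m-n L-1-even uwuv-even) ww-even)
      where
      isolate : ∀ a b c d → a + b + c + d - + 1 - (a + b) - d ≡ c - + 1
      isolate = solve-∀

    P-odd : + 2 ∣ P + + 1
    P-odd = subst (+ 2 ∣_) (rearrange (s-net t) (+ #vv t) (r-net t) ε)
      (∣m∣n⇒∣m-n (∣m∣n⇒∣m-n (proj₂ (tally-s w)) vv-odd) (divides (ε * r-net t) refl))
      where
      rearrange : ∀ S v R ε → S + v - (v - + 1) - ε * R * + 2 ≡ S - + 2 * ε * R + + 1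
      rearrange = solve-∀

    -- Some V–V edge is used, so the loop passes through a U–V edge.
    uv-used : #uv t ≢ 0
    uv-used uv≡0 = 2∤1 (∣m⇒∣-m (subst (λ v → + 2 ∣ + v - + 1) (tally-notV w uv≡0 _) vv-odd))

    P-small : ∣ P ∣ ℕ.< K
    P-small = begin-strict
      ∣ P ∣                                    ≤⟨ ℤP.∣i-j∣≤∣i∣+∣j∣ (s-net t) (+ 2 * ε * r-net t) ⟩
      ∣ s-net t ∣ ℕ.+ ∣ + 2 * ε * r-net t ∣   ≤⟨ ℕP.+-mono-≤ (proj₁ (tally-s w)) (ℕP.≤-trans (ℕP.≤-reflexive r-part) (tally-φ w)) ⟩
      #vv t ℕ.+ #uw t                          <⟨ ℕP.m<m+n (#vv t ℕ.+ #uw t) (ℕP.n≢0⇒n>0 uv-used) ⟩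
      #vv t ℕ.+ #uw t ℕ.+ #uv t                ≤⟨ ℕP.m≤m+n _ (#ww t) ⟩
      #vv t ℕ.+ #uw t ℕ.+ #uv t ℕ.+ #ww t      ≡⟨ regroup (#vv t) (#uw t) (#uv t) (#ww t) ⟩
      #uw t ℕ.+ #uv t ℕ.+ #vv t ℕ.+ #ww t      ≡⟨ tally-length w ⟨
      L                                        ≤⟨ L≤K ⟩
      K                                        ∎
      where
      open ℕP.≤-Reasoning
      r-part : ∣ + 2 * ε * r-net t ∣ ≡ ∣ + 2 * r-net t + + 1 - + 1 ∣
      r-part = trans (cong ∣_∣ (factor ε (r-net t))) (unit-abs unit _)
        where
        factor : ∀ ε R → + 2 * ε * R ≡ ε * (+ 2 * R + + 1 - + 1)
        factor = solve-∀
      regroup : ∀ a b c d → a ℕ.+ b ℕ.+ c ℕ.+ d ≡ b ℕ.+ c ℕ.+ a ℕ.+ d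
      regroup = ℕSolver.solve-∀

    impossible : ⊥
    impossible = 2∤1 (subst (λ p → + 2 ∣ p + + 1) (ℤP.∣i∣≡0⇒i≡0 {P} (below-divisor P-small K∣P)) P-odd)

  no-odd-loop-at-u : ∀ {i} → ¬ OddClosedWalk K (U , i)
  no-odd-loop-at-u (L , L-odd , L≤K , w) = Loop.impossible w L-odd L≤K

-- For even s, the walk v_i, v_{i+s}, …, v_{i+ks} = v_i is a closed walk of odd
-- length k, since k·s ≡ 0 (mod 2k).
module OddLoopAtV (k′ : ℕ) (r s : ℤ₂ (suc k′)) where
  open T2 k′ r s

  s-walk : ∀ n (i : Ix) → ∃ λ j → Gap i j (offset (+ 0) (+ n) (+ 0)) × Walk n (V , i) (V , j)
  s-walk zero i = i , gap-refl , []
  s-walk (suc n) i = extend (s-walk n (i ⊕ toℕ s))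
    where
    extend : (∃ λ j → Gap (i ⊕ toℕ s) j (offset (+ 0) (+ n) (+ 0)) × Walk n (V , i ⊕ toℕ s) (V , j)) →
             ∃ λ j → Gap i j (offset (+ 0) (+ suc n) (+ 0)) × Walk (suc n) (V , i) (V , j)
    extend (j , g , w) = j , shift-s i ⨾ g , edge-adj (v-v⁺ (shift-s i)) ∷ w

  odd-loop-at-v : Odd K → + 2 ∣ σ → ∀ i → OddClosedWalk K (V , i)
  odd-loop-at-v k-odd s-even i = close (s-walk K i)
    where
    ks≡0 : + 2 ∣ σ → Vanishes (offset (+ 0) (+ K) (+ 0))
    ks≡0 (divides q σ≡) = vanishes (divides q (trans (cong (λ z → + 0 * ρ + κ * z + + 0 * κ) σ≡) (regroup ρ κ q)))
      where
      regroup : ∀ r k q → + 0 * r + k * (q * + 2) + + 0 * k ≡ q * (k + k)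
      regroup = solve-∀
    close : (∃ λ j → Gap i j (offset (+ 0) (+ K) (+ 0)) × Walk K (V , i) (V , j)) → OddClosedWalk K (V , i)
    close (j , g , w) = K , k-odd , ℕP.≤-refl , subst (λ l → Walk K (V , i) (V , l)) (gap-vanishing g (ks≡0 s-even)) w

-- For odd s with c·s ≡ 1 (mod 2k) and ε·r + 2s ≡ 0, multiplication by −ε·c is an
-- isomorphism T₂(k,r,s) ≅ T₂(k,2,1).
module OddS (k′ : ℕ) (r s two one : ℤ₂ (suc k′)) (two≡2 : toℕ two ≡ 2) (one≡1 : toℕ one ≡ 1) where
  open T2 k′ r s
  open ScalingIso k′ r s two one

  private
    ι-two : ι two ≡ + 2
    ι-two = cong +_ two≡2

    ι-one : ι one ≡ + 1
    ι-one = cong +_ one≡1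

    odd-times-k : ∀ {c} → + 2 ∣ c - + 1 → + N ∣ (c - + 1) * κ
    odd-times-k {c} (divides q c-1≡) = divides q (trans (cong (_* κ) c-1≡) (double q κ))
      where
      double : ∀ q k → q * + 2 * k ≡ q * (k + k)
      double = solve-∀

  iso : ∀ {ε} → Unit ε → Vanishes (offset ε (+ 2) (+ 0)) → (c : ℤ) → + N ∣ c * σ - + 1 → + 2 ∣ c - + 1 →
        Isomorphic K r s two one
  iso (inj₁ refl) (vanishes z) c cσ≡1 c-odd = scaling-iso (- c) (- σ)
    (subst (+ N ∣_) (νμ c σ) cσ≡1)
    (subst (+ N ∣_) (trans (hr c ρ σ κ) (cong (λ t → - c * ρ - t) (sym ι-two))) (∣m∣n⇒∣m+n (∣n⇒∣m*n (- c) z) (∣n⇒∣m*n (+ 2) cσ≡1)))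
    (inj₂ (subst (+ N ∣_) (trans (hs c σ) (cong (λ t → - c * σ + t) (sym ι-one))) (∣m⇒∣-m cσ≡1)))
    (subst (+ N ∣_) (hk c κ) (∣m∣n⇒∣m-n (∣m⇒∣-m (odd-times-k {c} c-odd)) N∣2κ))
    where
    νμ : ∀ c s → c * s - + 1 ≡ - s * - c - + 1
    νμ = solve-∀
    hr : ∀ c r s k → - c * (+ 1 * r + + 2 * s + + 0 * k) + + 2 * (c * s - + 1) ≡ - c * r - + 2
    hr = solve-∀
    hs : ∀ c s → - (c * s - + 1) ≡ - c * s + + 1
    hs = solve-∀
    hk : ∀ c k → - ((c - + 1) * k) - (k + k) ≡ - c * k - k
    hk = solve-∀
  iso (inj₂ refl) (vanishes z) c cσ≡1 c-odd = scaling-iso c σ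
    (subst (λ t → + N ∣ t - + 1) (ℤP.*-comm c σ) cσ≡1)
    (subst (+ N ∣_) (trans (hr c ρ σ κ) (cong (λ t → c * ρ - t) (sym ι-two))) (∣m∣n⇒∣m+n (∣n⇒∣m*n (- c) z) (∣n⇒∣m*n (+ 2) cσ≡1)))
    (inj₁ (subst (λ t → + N ∣ c * σ - t) (sym ι-one) cσ≡1))
    (subst (+ N ∣_) (hk c κ) (odd-times-k {c} c-odd))
    where
    hr : ∀ c r s k → - c * (- + 1 * r + + 2 * s + + 0 * k) + + 2 * (c * s - + 1) ≡ c * r - + 2
    hr = solve-∀
    hk : ∀ c k → (c - + 1) * k ≡ c * k - k
    hk = solve-∀

module Classification (k′ : ℕ) (k>9 : 9 ℕ.< suc k′) (k-odd : Odd (suc k′)) (r s : ℤ₂ (suc k′))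
                      (connected : Connected (suc k′) r s) (simple : Simple (suc k′) r s)
                      (transitive : VertexTransitive (suc k′) r s)
                      (two one : ℤ₂ (suc k′)) (two≡2 : toℕ two ≡ 2) (one≡1 : toℕ one ≡ 1) where
  open T2 k′ r s
  open SimpleT2 simple
  open LoopsAtV k′ r s
  open Witnesses k′ r s r≉0
  open OddLoopAtV k′ r s

  i₀ : Ix
  i₀ = Fin.zero

  -- When every common divisor of s and k divides r, connectivity makes s and k coprime.
  module CoprimeSK (r-determined : ∀ {d} → d ∣ σ → d ∣ κ → d ∣ ρ) where
    no-shared : ∀ {d} → 2 ℕ.≤ d → d ℕD.∣ K → + d ∣ σ → ⊥
    no-shared 2≤d d∣K d∣σ =
      CommonDivisor.disconnected (r-determined d∣σ (∣ᵤ⇒∣ d∣K)) d∣σ (∣ᵤ⇒∣ d∣K) 2≤d connected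

    coprime : Coprime (toℕ s) K
    coprime {zero} (_ , 0∣K) = ⊥-elim (ℕP.1+n≢0 (ℕD.0∣⇒≡0 0∣K))
    coprime {suc zero} _ = refl
    coprime {suc (suc d)} (d∣s , d∣K) = ⊥-elim (no-shared (s≤s (s≤s z≤n)) d∣K (∣ᵤ⇒∣ d∣s))

  -- Case ε·r + 2s ≡ 0 with ε = ±1.  Then s is coprime to k.  For even s the
  -- v-vertices lie on short odd loops but the u-vertices do not, contradicting
  -- vertex transitivity; for odd s, scaling by an inverse of s gives T₂(k,2,1).
  r≈∓2s : ∀ {ε} → Unit ε → Vanishes (offset ε (+ 2) (+ 0)) → Isomorphic K r s two one
  r≈∓2s {ε} unit h = by-parity (parity (toℕ s))
    where
    open CoprimeSK (Dependence.r-determined k′ r s ε (unit-square unit) h)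
    by-parity : (∃ λ q → toℕ s ≡ 2 ℕ.* q) ⊎ Odd (toℕ s) → Isomorphic K r s two one
    by-parity (inj₁ (q , s≡2q)) = ⊥-elim (no-odd-loop-at-u
        (move transitive {OddClosedWalk K} (λ f hom inj → Image.oddClosedWalk f hom inj)
              (V , i₀) (U , i₀) (odd-loop-at-v k-odd s-even i₀)))
      where
      s-even : + 2 ∣ σ
      s-even = divides (+ q) (trans (cong +_ s≡2q) (trans (ℤP.pos-* 2 q) (ℤP.*-comm (+ 2) (+ q))))
      open NoOddLoopAtU k′ r s ε unit h s-even k-odd (coprime-sym coprime)
    by-parity (inj₂ s-odd) = invert (inverse-mod (coprime-to-double coprime s-odd))
      where
      invert : (∃ λ c → + N ∣ c * σ - + 1) → Isomorphic K r s two one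
      invert (c , cσ≡1) = OddS.iso k′ r s two one two≡2 one≡1 unit h c cσ≡1 (odd-inverse c 2∣N cσ≡1 s-odd)

  -- Cases r ≡ ±s or r ≡ ±(s + k): some u-vertex has three pairwise angles, hence
  -- so does v₀; its loops force ε·r + 2s ≡ 0, or m·s ≡ 0 with 3 ≤ m ≤ 6, which is
  -- impossible as no d ≥ 2 divides s and k, and k is odd and greater than 9.
  r≈±s : ∀ {ε b c x} → Unit ε → Vanishes (offset ε b c) → ThreeAngles x → Isomorphic K r s two one
  r≈±s {ε} {x = x} unit h angles =
    by-relation (three-angles-at-v
      (move transitive {ThreeAngles} (λ f hom inj → Image.threeAngles f hom inj) x (V , i₀) angles))
    where
    open CoprimeSK (Dependence.r-determined k′ r s ε (unit-square unit) h)
    open SmallOrder k′ r s k-odd k>9 no-shared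
    by-relation : RelationViaV → Isomorphic K r s two one
    by-relation (2s≈r z)  = r≈∓2s (inj₂ refl) z
    by-relation (2s≈-r z) = r≈∓2s (inj₁ refl) z
    by-relation (3s≈0 z)  = ⊥-elim (not-3s z)
    by-relation (4s≈0 z)  = ⊥-elim (not-4s z)
    by-relation (5s≈0 z)  = ⊥-elim (not-5s z)
    by-relation (6s≈0 z)  = ⊥-elim (not-6s z)

  -- w-vertices have two angles with a common arm, hence so has v₀, forcing one of
  -- the relations handled above (s + k ≡ 0 would give 2s ≡ 0).
  theorem : Isomorphic K r s two one
  theorem = by-relation (two-angles-at-v
    (move transitive {TwoAngles} (λ f hom inj → Image.twoAngles f hom inj)
          (W , ix 1 0 0) (V , i₀) two-angles-at-w))
    where
    by-relation : RelationViaU → Isomorphic K r s two one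
    by-relation (s≈r h)    = r≈±s (inj₂ refl) h (three-angles-if-s≈r h)
    by-relation (s≈-r h)   = r≈±s (inj₁ refl) h (three-angles-if-s≈-r h)
    by-relation (s+k≈r h)  = r≈±s (inj₂ refl) h (three-angles-if-s+k≈r h)
    by-relation (s+k≈-r h) = r≈±s (inj₁ refl) h (three-angles-if-s+k≈-r h)
    by-relation (2s≈r h)   = r≈∓2s (inj₂ refl) h
    by-relation (2s≈-r h)  = r≈∓2s (inj₁ refl) h
    by-relation (s+k≈0 h)  = ⊥-elim (2s≉0 (vanishes-⊞ (vanishes-⊞ h h) (vanishes-⊟ vanishes-2k)))

lemma5p9 : (k : ℕ) → 9 ℕ.< k → Odd k → (r s : ℤ₂ k) →
    Connected k r s → Simple k r s → VertexTransitive k r s →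
    (two one : ℤ₂ k) → toℕ two ≡ 2 → toℕ one ≡ 1 →
    Isomorphic k r s two one
lemma5p9 zero ()
lemma5p9 (suc k′) k>9 k-odd r s connected simple transitive two one two≡2 one≡1 =
  Classification.theorem k′ k>9 k-odd r s connected simple transitive two one two≡2 one≡1
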